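{- For all positive integers $r,n$, the following identity holds in $\mathbb{Z}[[z_0,\ldots,z_n]]$: \[ \sum_{ k \ge 0 } \prod_{ j=1 }^n [k+1]_{ z_j } \, z_0^k \ = \ \sum_{\pi\in S_n} \sum_{(\rho,\epsilon)\in I_{r,n}} \frac{\displaystyle \prod_{j\in \mathrm{Des}(\pi)} z_0z_{\pi(1)}z_{\pi(2)}\cdots z_{\pi(j)} \prod_{j\in \mathrm{NNeg}((\rho,\epsilon)^{ -1})} z_0z_{\pi(1)}z_{\pi(2)}\cdots z_{\pi(j)} }{\displaystyle (1-z_0)\prod_{j=1}^n \left(1-z_0^r z_{\pi(1)}^r\cdots z_{\pi(j)}^r \right) } \, , \] where the second product in the numerator runs over the multiset $\mathrm{NNeg}((\rho,\epsilon)^{ -1})$ with multiplicity (each $j$ contributing as many factors as its multiplicity).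
   Context: $[m]_z=1+z+\cdots+z^{m-1}$. For $\pi\in S_n$, $\mathrm{Des}(\pi)=\{j\in[n-1]:\pi(j)>\pi(j+1)\}$. Let $\omega=e^{2\pi i/r}$. The wreath product $\mathbb{Z}_r\wr S_n$ consists of pairs $(\pi,\epsilon)$ with $\pi\in S_n$, $\epsilon_j=\omega^{c_j}$, $c_j\in\{0,\ldots,r-1\}$ (colors). Identify $(\pi,\epsilon)$ with the $n\times n$ matrix with entry $\epsilon_i$ in position $(\pi(i),i)$ and zeros elsewhere; group operation and inverses are matrix multiplication and matrix inverse. Window notation: $[\pi(1)^{c_1}\cdots\pi(n)^{c_n}]$. Totally order pairs $j^{c}$ by $j^{c}<k^{d}$ if $c>d$, or $c=d$ and $j<k$. $\mathrm{Des}_A(\pi,\epsilon)=\{i\in[n-1]:\pi(i)^{c_i}>\pi(i+1)^{c_{i+1}}\}$, and $I_{r,n}$ is the set of elements with $\mathrm{Des}_A=\emptyset$. For $(\sigma,\delta)$ with colors $d_i$, $\mathrm{NNeg}(\sigma,\delta)$ is the multiset containing each $i\in[n]$ with multiplicity $d_i$; equivalently, $\mathrm{NNeg}((\rho,\epsilon)^{ -1})$ contains $\rho(i)$ with multiplicity $(r-c_i)\bmod r$. -}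

module Defs where

open import Data.Bool using (Bool; true; false; if_then_else_; _∧_; _∨_; not)
open import Data.Nat as ℕ using (ℕ; zero; suc; _∸_; _≡ᵇ_; _<ᵇ_)
import Data.Nat.Properties as ℕP
open import Data.Fin as Fin using (Fin; toℕ)
import Data.Fin.Properties as FinP
open import Data.Integer as ℤ using (ℤ)
open import Data.List as List using (List; []; _∷_; [_]; _++_; map; concatMap; upTo; filter; zip; take; foldr)
open import Data.List.Relation.Unary.Any using (any?)
open import Data.Vec as Vec using (Vec; []; _∷_; zipWith; replicate; tabulate; toList; head)
open import Data.Vec.Properties using (≡-dec)
open import Data.Product using (_×_; _,_; proj₁; proj₂)
open import Relation.Nullary using (does)
open import Relation.Binary.PropositionalEquality using (_≡_)

-- Formal power series in m variables with integer coefficients,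
-- represented by their coefficient function on exponent vectors.
-- For Z[[z_0,...,z_n]] we take m = suc n; coordinate 0 is z_0 and
-- coordinate j (j = 1..n) is z_j.

Exp : ℕ → Set
Exp m = Vec ℕ m

Series : ℕ → Set
Series m = Exp m → ℤ

sumℤ : List ℤ → ℤ
sumℤ = foldr ℤ._+_ (ℤ.+ 0)

below : ∀ {m} → Exp m → List (Exp m)
below [] = [ [] ]
below (x ∷ xs) = concatMap (λ a → map (a ∷_) (below xs)) (upTo (suc x))

addE : ∀ {m} → Exp m → Exp m → Exp m
addE = zipWith ℕ._+_

scaleE : ∀ {m} → ℕ → Exp m → Exp m
scaleE t = Vec.map (t ℕ.*_)

zeroE : ∀ {m} → Exp m
zeroE = replicate _ 0

unitE : ∀ {m} → Fin m → Exp m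
unitE i = tabulate (λ k → if does (k Fin.≟ i) then 1 else 0)

0s : ∀ {m} → Series m
0s _ = ℤ.+ 0

_+s_ : ∀ {m} → Series m → Series m → Series m
(f +s g) e = f e ℤ.+ g e

_*s_ : ∀ {m} → Series m → Series m → Series m
(f *s g) e = sumℤ (map (λ a → f a ℤ.* g (zipWith _∸_ e a)) (below e))

mono : ∀ {m} → Exp m → Series m
mono a e = if does (≡-dec ℕP._≟_ a e) then ℤ.+ 1 else ℤ.+ 0

1s : ∀ {m} → Series m
1s = mono zeroE

sumS : ∀ {m} → List (Series m) → Series m
sumS = foldr _+s_ 0s

prodS : ∀ {m} → List (Series m) → Series m
prodS = foldr _*s_ 1s

-- 1 / (1 - z^a) = Σ_{t ≥ 0} z^{t a}, for a nonzero exponent vector a.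
-- The coefficient at e only receives contributions from t ≤ |e|
-- (since a ≠ 0), so the sum is truncated there.
geomInv : ∀ {m} → Exp m → Series m
geomInv a e = sumℤ (map (λ t → mono (scaleE t a) e) (upTo (suc (Vec.sum e))))

qint : ∀ {m} → Fin m → ℕ → Series m
qint i k = sumS (map (λ a → mono (scaleE a (unitE i))) (upTo k))

-- Permutations of [n] in window notation: lists of values in Fin n
-- (value v : Fin n stands for toℕ v + 1), of length n, without repeats.

allVecs : ∀ {A : Set} → List A → (k : ℕ) → List (Vec A k)
allVecs xs zero = [ [] ]
allVecs xs (suc k) = concatMap (λ x → map (x ∷_) (allVecs xs k)) xs

memB : ∀ {n} → Fin n → List (Fin n) → Bool
memB x [] = false
memB x (y ∷ ys) = does (x Fin.≟ y) ∨ memB x ys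

distinctB : ∀ {n} → List (Fin n) → Bool
distinctB [] = true
distinctB (x ∷ xs) = not (memB x xs) ∧ distinctB xs

Sn : (n : ℕ) → List (Vec (Fin n) n)
Sn n = filter (λ π → Data.Bool.T? (distinctB (toList π))) (allVecs (List.allFin n) n)
  where import Data.Bool

-- Des(π) as a list of positions j ∈ [n-1] (1-based) with π(j) > π(j+1)
desFrom : ∀ {n} → ℕ → List (Fin n) → List ℕ
desFrom j [] = []
desFrom j (x ∷ []) = []
desFrom j (x ∷ y ∷ t) =
  (if toℕ y <ᵇ toℕ x then [ j ] else []) ++ desFrom (suc j) (y ∷ t)

Des : ∀ {n} → Vec (Fin n) n → List ℕ
Des π = desFrom 1 (toList π)

-- exponent vector of z_0 z_{π(1)} z_{π(2)} ... z_{π(j)}  (in Z[[z_0..z_n]])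
prefE : ∀ {n} → Vec (Fin n) n → ℕ → Exp (suc n)
prefE {n} π j = 1 ∷ tabulate (λ i → if memB i (take j (toList π)) then 1 else 0)

-- Colored permutations Z_r ≀ S_n in window notation [π(1)^{c_1} ... π(n)^{c_n}],
-- colors c_i ∈ {0,...,r-1}.

Colored : ℕ → Set
Colored n = Vec (Fin n) n × Vec ℕ n

allColored : (r n : ℕ) → List (Colored n)
allColored r n = concatMap (λ π → map (π ,_) (allVecs (upTo r) n)) (Sn n)

-- j^c > k^d  in the total order  j^c < k^d  iff  c > d, or c = d and j < k
gtPair : ∀ {n} → (Fin n × ℕ) → (Fin n × ℕ) → Bool
gtPair (j , c) (k , d) = (c <ᵇ d) ∨ ((c ≡ᵇ d) ∧ (toℕ k <ᵇ toℕ j))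

desAFrom : ∀ {n} → ℕ → List (Fin n × ℕ) → List ℕ
desAFrom j [] = []
desAFrom j (x ∷ []) = []
desAFrom j (x ∷ y ∷ t) =
  (if gtPair x y then [ j ] else []) ++ desAFrom (suc j) (y ∷ t)

DesA : ∀ {n} → Colored n → List ℕ
DesA (π , c) = desAFrom 1 (toList (Vec.zip π c))

isNil : List ℕ → Bool
isNil [] = true
isNil (_ ∷ _) = false

I : (r n : ℕ) → List (Colored n)
I r n = filter (λ w → Data.Bool.T? (isNil (DesA w))) (allColored r n)
  where import Data.Bool

negCol : ℕ → ℕ → ℕ
negCol r c = if c ≡ᵇ 0 then 0 else r ∸ c

-- NNeg((ρ,ε)^{-1}) as a list of pairs (value j ∈ [n] (1-based), multiplicity):
-- contains ρ(i) with multiplicity (r - c_i) mod r.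
NNegInv : ∀ {n} → ℕ → Colored n → List (ℕ × ℕ)
NNegInv r (ρ , c) = toList (zipWith (λ v ci → (suc (toℕ v) , negCol r ci)) ρ c)

-- Σ_{k ≥ 0} Π_{j=1}^n [k+1]_{z_j} z_0^k.  The k-th summand is divisible by
-- z_0^k exactly (and by no higher power), so the coefficient at e only gets
-- contributions from k ≤ e_0.
lhsTerm : (n : ℕ) → ℕ → Series (suc n)
lhsTerm n k = prodS (map (λ j → qint (Fin.suc j) (suc k)) (List.allFin n))
              *s mono (k ∷ zeroE)

LHS : (n : ℕ) → Series (suc n)
LHS n e = sumℤ (map (λ k → lhsTerm n k e) (upTo (suc (head e))))

numeratorE : ∀ {n} → ℕ → Vec (Fin n) n → Colored n → Exp (suc n)
numeratorE r π w =
  addE (foldr (λ j acc → addE (prefE π j) acc) zeroE (Des π))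
       (foldr (λ p acc → addE (scaleE (proj₂ p) (prefE π (proj₁ p))) acc) zeroE (NNegInv r w))

rhsTerm : (r n : ℕ) → Vec (Fin n) n → Colored n → Series (suc n)
rhsTerm r n π w =
  mono (numeratorE r π w)
  *s (geomInv (1 ∷ zeroE)
  *s prodS (map (λ j → geomInv (scaleE r (prefE π j))) (List.map suc (upTo n))))

RHS : (r n : ℕ) → Series (suc n)
RHS r n = sumS (concatMap (λ π → map (rhsTerm r n π) (I r n)) (Sn n))

-- Both sides are compared coefficientwise at z₀^e₀ z₁^x₁ ⋯ zₙ^xₙ, and each coefficient is the
-- indicator of x₁, …, xₙ ≤ e₀. On the left the k-th term contributes exactly when k = e₀ and all xⱼ ≤ k.
-- On the right, expanding every 1/(1 − z^a) as a geometric series shows that the summand for π and (ρ,ε)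
-- contributes 1 exactly when x_{π(1)} ≤ e₀ and each x_{π(k)} − x_{π(k+1)} (with x_{π(n+1)} = 0) is
-- [k ∈ Des π] + mult_k NNeg((ρ,ε)⁻¹) plus a non-negative multiple of r, and 0 otherwise. Such a staircase
-- forces π to list [n] by decreasing x with ties broken by increasing index, and it forces the
-- multiplicities mod r, hence the colours; as Des_A(ρ,ε) = ∅ then determines ρ, at most one summand
-- contributes, and when all xⱼ ≤ e₀ sorting and reading off the residues produces one.
module Submission where

open import Defs
open import Function using (_∘_; id)
open import Data.Empty using (⊥-elim)
open import Data.Unit using (⊤; tt)
open import Data.Bool using (Bool; true; false; if_then_else_; _∨_; _∧_; T; T?)
import Data.Bool.Properties as BP
open import Data.Nat as ℕ using (ℕ; zero; suc; _<_; _≤_; z≤n; s≤s; _∸_; _*_; _+_; _<ᵇ_; _≡ᵇ_)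
import Data.Nat.Properties as ℕP
open import Algebra.Properties.CommutativeSemigroup ℕP.+-commutativeSemigroup using () renaming (interchange to +-interchange)
open import Data.Nat.Solver using (module +-*-Solver)
open +-*-Solver using (solve; _:+_; _:*_; _:=_)
open import Data.Nat.DivMod using (_%_; _/_; m<n⇒m%n≡m; [m+kn]%n≡m%n; m%n<n; m≡m%n+[m/n]*n)
open import Data.Integer as ℤ using (ℤ; 0ℤ; 1ℤ) renaming (_+_ to _+ℤ_; _*_ to _*ℤ_)
import Data.Integer.Properties as ℤP
open import Data.Fin as Fin using (Fin; zero; suc; toℕ; punchOut)
import Data.Fin.Properties as FinP
open import Data.List as List using (List; []; _∷_; map; concatMap; filter; upTo; applyUpTo; _++_; [_]; length; take; foldr)
import Data.List.Properties as LP
import Data.Product.Properties as ×P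
open import Level using (0ℓ)
open import Relation.Nullary.Decidable using (dec-true; dec-false)
open import Data.List.Relation.Unary.All as All using (All; []; _∷_)
import Data.List.Relation.Unary.All.Properties as AllP
open import Data.Vec as Vec using (Vec; []; _∷_; zipWith; lookup; tabulate; toList; zip)
import Data.Vec.Properties as VP
open import Data.Vec.Relation.Binary.Pointwise.Inductive as Pw using (Pointwise; []; _∷_)
open import Data.Product using (Σ; _×_; _,_; proj₁; proj₂; ∃)
open import Data.Sum using (_⊎_; inj₁; inj₂)
open import Relation.Binary using (DecidableEquality; tri<; tri≈; tri>)
open import Relation.Binary.PropositionalEquality hiding ([_])
open import Relation.Nullary using (¬_; Dec; yes; no; does; _because_; ofⁿ)
open import Relation.Unary using (Pred; Decidable)

sumUp : ℕ → (ℕ → ℤ) → ℤ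
sumUp zero f = 0ℤ
sumUp (suc N) f = f 0 +ℤ sumUp N (f ∘ suc)

sumℤ-++ : (xs ys : List ℤ) → sumℤ (xs ++ ys) ≡ sumℤ xs +ℤ sumℤ ys
sumℤ-++ [] ys = sym (ℤP.+-identityˡ _)
sumℤ-++ (x ∷ xs) ys = trans (cong (x +ℤ_) (sumℤ-++ xs ys)) (sym (ℤP.+-assoc x _ _))

sumℤ-concatMap : ∀ {A B : Set} (h : B → ℤ) (f : A → List B) (L : List A) →
  sumℤ (map h (concatMap f L)) ≡ sumℤ (map (λ a → sumℤ (map h (f a))) L)
sumℤ-concatMap h f [] = refl
sumℤ-concatMap h f (a ∷ L) = begin
    sumℤ (map h (f a ++ concatMap f L))
  ≡⟨ cong sumℤ (LP.map-++ h (f a) (concatMap f L)) ⟩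
    sumℤ (map h (f a) ++ map h (concatMap f L))
  ≡⟨ sumℤ-++ (map h (f a)) _ ⟩
    sumℤ (map h (f a)) +ℤ sumℤ (map h (concatMap f L))
  ≡⟨ cong (sumℤ (map h (f a)) +ℤ_) (sumℤ-concatMap h f L) ⟩
    sumℤ (map (λ a → sumℤ (map h (f a))) (a ∷ L)) ∎
  where open ≡-Reasoning

sumℤ-map-∘ : ∀ {A B : Set} (h : B → ℤ) (g : A → B) (L : List A) →
  sumℤ (map h (map g L)) ≡ sumℤ (map (h ∘ g) L)
sumℤ-map-∘ h g L = cong sumℤ (sym (LP.map-∘ L))

sumℤ-upTo : (h : ℕ → ℤ) (N : ℕ) → sumℤ (map h (upTo N)) ≡ sumUp N h
sumℤ-upTo h N = go id N
  where
  go : (g : ℕ → ℕ) (N : ℕ) → sumℤ (map h (applyUpTo g N)) ≡ sumUp N (h ∘ g)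
  go g zero = refl
  go g (suc N) = cong (h (g 0) +ℤ_) (go (g ∘ suc) N)

sumℤ-cong : ∀ {A : Set} {f g : A → ℤ} (L : List A) → (∀ x → f x ≡ g x) → sumℤ (map f L) ≡ sumℤ (map g L)
sumℤ-cong [] eq = refl
sumℤ-cong (x ∷ L) eq = cong₂ _+ℤ_ (eq x) (sumℤ-cong L eq)

sumUp-cong : ∀ N {f g : ℕ → ℤ} → (∀ t → t < N → f t ≡ g t) → sumUp N f ≡ sumUp N g
sumUp-cong zero eq = refl
sumUp-cong (suc N) eq = cong₂ _+ℤ_ (eq 0 (s≤s z≤n)) (sumUp-cong N (λ t lt → eq (suc t) (s≤s lt)))

sumUp-zero : ∀ N {f : ℕ → ℤ} → (∀ t → t < N → f t ≡ 0ℤ) → sumUp N f ≡ 0ℤ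
sumUp-zero zero eq = refl
sumUp-zero (suc N) eq = cong₂ _+ℤ_ (eq 0 (s≤s z≤n)) (sumUp-zero N (λ t lt → eq (suc t) (s≤s lt)))

sumUp-single : ∀ N t* {f : ℕ → ℤ} → t* < N → (∀ t → t < N → t ≢ t* → f t ≡ 0ℤ) → sumUp N f ≡ f t*
sumUp-single (suc N) zero {f} lt eq =
  trans (cong (f 0 +ℤ_) (sumUp-zero N (λ t lt' → eq (suc t) (s≤s lt') (λ ())))) (ℤP.+-identityʳ _)
sumUp-single (suc N) (suc t*) (s≤s lt) eq =
  trans (cong₂ _+ℤ_ (eq 0 (s≤s z≤n) (λ ()))
                     (sumUp-single N t* lt (λ t lt' ne → eq (suc t) (s≤s lt') (ne ∘ ℕP.suc-injective))))
        (ℤP.+-identityˡ _)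

sumUp-+ : ∀ N (f g : ℕ → ℤ) → sumUp N (λ t → f t +ℤ g t) ≡ sumUp N f +ℤ sumUp N g
sumUp-+ zero f g = refl
sumUp-+ (suc N) f g = trans (cong ((f 0 +ℤ g 0) +ℤ_) (sumUp-+ N (f ∘ suc) (g ∘ suc)))
  (interchange (f 0) (g 0) (sumUp N (f ∘ suc)) (sumUp N (g ∘ suc)))
  where open import Algebra.Properties.CommutativeSemigroup ℤP.+-commutativeSemigroup using (interchange)

sumUp-*ʳ : ∀ N (f : ℕ → ℤ) c → sumUp N f *ℤ c ≡ sumUp N (λ t → f t *ℤ c)
sumUp-*ʳ zero f c = ℤP.*-zeroˡ c
sumUp-*ʳ (suc N) f c = trans (ℤP.*-distribʳ-+ c (f 0) _) (cong (f 0 *ℤ c +ℤ_) (sumUp-*ʳ N (f ∘ suc) c))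

sumUp-swap : ∀ N M (F : ℕ → ℕ → ℤ) →
  sumUp N (λ t → sumUp M (λ s → F t s)) ≡ sumUp M (λ s → sumUp N (λ t → F t s))
sumUp-swap zero M F = sym (sumUp-zero M (λ _ _ → refl))
sumUp-swap (suc N) M F = trans (cong (sumUp M (F 0) +ℤ_) (sumUp-swap N M (F ∘ suc)))
  (sym (sumUp-+ M (F 0) (λ s → sumUp N (λ t → F (suc t) s))))

sumUp-extend : ∀ M N {f : ℕ → ℤ} → M ≤ N → (∀ t → M ≤ t → t < N → f t ≡ 0ℤ) → sumUp N f ≡ sumUp M f
sumUp-extend zero N le eq = sumUp-zero N (λ t lt → eq t z≤n lt)
sumUp-extend (suc M) (suc N) {f} (s≤s le) eq =
  cong (f 0 +ℤ_) (sumUp-extend M N le (λ t le' lt → eq (suc t) (s≤s le') (s≤s lt)))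

infix 4 _≤v_ _≤v?_
_≤v_ : ∀ {m} → Exp m → Exp m → Set
_≤v_ = Pointwise _≤_

_≤v?_ : ∀ {m} (a b : Exp m) → Dec (a ≤v b)
_≤v?_ = Pw.decidable ℕP._≤?_

infixl 6 _∸v_
_∸v_ : ∀ {m} → Exp m → Exp m → Exp m
_∸v_ = zipWith _∸_

sumBelow : ∀ {m} → Exp m → (Exp m → ℤ) → ℤ
sumBelow [] h = h []
sumBelow (x ∷ xs) h = sumUp (suc x) (λ c → sumBelow xs (λ bs → h (c ∷ bs)))

sumℤ-below : ∀ {m} (e : Exp m) (h : Exp m → ℤ) → sumℤ (map h (below e)) ≡ sumBelow e h
sumℤ-below [] h = ℤP.+-identityʳ _
sumℤ-below (x ∷ xs) h = begin
    sumℤ (map h (concatMap (λ a → map (a ∷_) (below xs)) (upTo (suc x))))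
  ≡⟨ sumℤ-concatMap h (λ a → map (a ∷_) (below xs)) (upTo (suc x)) ⟩
    sumℤ (map (λ a → sumℤ (map h (map (a ∷_) (below xs)))) (upTo (suc x)))
  ≡⟨ sumℤ-cong (upTo (suc x)) (λ a → trans (sumℤ-map-∘ h (a ∷_) (below xs)) (sumℤ-below xs (λ bs → h (a ∷ bs)))) ⟩
    sumℤ (map (λ a → sumBelow xs (λ bs → h (a ∷ bs))) (upTo (suc x)))
  ≡⟨ sumℤ-upTo (λ a → sumBelow xs (λ bs → h (a ∷ bs))) (suc x) ⟩
    sumBelow (x ∷ xs) h ∎
  where open ≡-Reasoning

sumBelow-cong : ∀ {m} (e : Exp m) {f g : Exp m → ℤ} → (∀ b → b ≤v e → f b ≡ g b) → sumBelow e f ≡ sumBelow e g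
sumBelow-cong [] eq = eq [] []
sumBelow-cong (x ∷ xs) eq = sumUp-cong (suc x) (λ { c (s≤s lt) → sumBelow-cong xs (λ bs le → eq (c ∷ bs) (lt ∷ le)) })

sumBelow-zero : ∀ {m} (e : Exp m) {f : Exp m → ℤ} → (∀ b → b ≤v e → f b ≡ 0ℤ) → sumBelow e f ≡ 0ℤ
sumBelow-zero [] eq = eq [] []
sumBelow-zero (x ∷ xs) eq = sumUp-zero (suc x) (λ { c (s≤s lt) → sumBelow-zero xs (λ bs le → eq (c ∷ bs) (lt ∷ le)) })

sumBelow-single : ∀ {m} (e a : Exp m) {f : Exp m → ℤ} → a ≤v e → (∀ b → b ≤v e → b ≢ a → f b ≡ 0ℤ) →
  sumBelow e f ≡ f a
sumBelow-single [] [] le eq = refl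
sumBelow-single (x ∷ xs) (a ∷ as) (l ∷ le) eq =
  trans (sumUp-single (suc x) a (s≤s l)
          (λ { c (s≤s lt) ne → sumBelow-zero xs (λ bs le' → eq (c ∷ bs) (lt ∷ le') (ne ∘ cong Vec.head)) }))
        (sumBelow-single xs as le (λ bs le' ne → eq (a ∷ bs) (l ∷ le') (ne ∘ cong Vec.tail)))

sumBelow-sumUp : ∀ {m} (e : Exp m) K (F : ℕ → Exp m → ℤ) →
  sumBelow e (λ b → sumUp K (λ t → F t b)) ≡ sumUp K (λ t → sumBelow e (F t))
sumBelow-sumUp [] K F = refl
sumBelow-sumUp (x ∷ xs) K F = trans (sumUp-cong (suc x) (λ c _ → sumBelow-sumUp xs K (λ t bs → F t (c ∷ bs))))
  (sumUp-swap (suc x) K (λ c t → sumBelow xs (λ bs → F t (c ∷ bs))))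

∸v-≤v : ∀ {m} (e b : Exp m) → e ∸v b ≤v e
∸v-≤v [] [] = []
∸v-≤v (x ∷ e) (y ∷ b) = ℕP.m∸n≤m x y ∷ ∸v-≤v e b

∸v-∸v : ∀ {m} (e c : Exp m) → c ≤v e → e ∸v (e ∸v c) ≡ c
∸v-∸v [] [] [] = refl
∸v-∸v (x ∷ e) (y ∷ c) (l ∷ le) = cong₂ _∷_ (ℕP.m∸[m∸n]≡n l) (∸v-∸v e c le)

zeroE-≤v : ∀ {m} (e : Exp m) → zeroE ≤v e
zeroE-≤v [] = []
zeroE-≤v (x ∷ e) = z≤n ∷ zeroE-≤v e

lookup-∸v : ∀ {m} (a b : Exp m) i → lookup (a ∸v b) i ≡ lookup a i ∸ lookup b i
lookup-∸v a b i = VP.lookup-zipWith _∸_ i a b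

lookup-addE : ∀ {m} (a b : Exp m) i → lookup (addE a b) i ≡ lookup a i + lookup b i
lookup-addE a b i = VP.lookup-zipWith _+_ i a b

lookup-scaleE : ∀ {m} t (a : Exp m) i → lookup (scaleE t a) i ≡ t * lookup a i
lookup-scaleE t a i = VP.lookup-map i (t *_) a

lookup-zeroE : ∀ {m} (i : Fin m) → lookup (zeroE {m}) i ≡ 0
lookup-zeroE i = VP.lookup-replicate i 0

lookup-unitE-≡ : ∀ {m} (i : Fin m) → lookup (unitE i) i ≡ 1
lookup-unitE-≡ i rewrite VP.lookup∘tabulate (λ k → if does (k Fin.≟ i) then 1 else 0) i with i Fin.≟ i
... | yes _ = refl
... | no ne = ⊥-elim (ne refl)

lookup-unitE-≢ : ∀ {m} (i k : Fin m) → k ≢ i → lookup (unitE i) k ≡ 0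
lookup-unitE-≢ i k ne rewrite VP.lookup∘tabulate (λ k → if does (k Fin.≟ i) then 1 else 0) k with k Fin.≟ i
... | yes e = ⊥-elim (ne e)
... | no _ = refl

≤v-from-lookup : ∀ {m} (a b : Exp m) → (∀ i → lookup a i ≤ lookup b i) → a ≤v b
≤v-from-lookup [] [] h = []
≤v-from-lookup (x ∷ a) (y ∷ b) h = h zero ∷ ≤v-from-lookup a b (h ∘ suc)

≡-from-lookup : ∀ {m} (a b : Exp m) → (∀ i → lookup a i ≡ lookup b i) → a ≡ b
≡-from-lookup [] [] h = refl
≡-from-lookup (x ∷ a) (y ∷ b) h = cong₂ _∷_ (h zero) (≡-from-lookup a b (h ∘ suc))

*s-sumBelow : ∀ {m} (f g : Series m) e → (f *s g) e ≡ sumBelow e (λ a → f a *ℤ g (e ∸v a))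
*s-sumBelow f g e = sumℤ-below e (λ a → f a *ℤ g (e ∸v a))

mono-refl : ∀ {m} (a : Exp m) → mono a a ≡ 1ℤ
mono-refl a with VP.≡-dec ℕP._≟_ a a
... | yes _ = refl
... | no ne = ⊥-elim (ne refl)

mono-≢ : ∀ {m} (a b : Exp m) → a ≢ b → mono a b ≡ 0ℤ
mono-≢ a b ne with VP.≡-dec ℕP._≟_ a b
... | yes e = ⊥-elim (ne e)
... | no _ = refl

1s-zeroE : ∀ {m} (y : Exp m) → y ≡ zeroE → 1s y ≡ 1ℤ
1s-zeroE {m} y refl = mono-refl {m} zeroE

1s-≢zeroE : ∀ {m} (y : Exp m) → y ≢ zeroE → 1s y ≡ 0ℤ
1s-≢zeroE y ne = mono-≢ zeroE y (ne ∘ sym)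

mono*s-≤ : ∀ {m} (a e : Exp m) (g : Series m) → a ≤v e → (mono a *s g) e ≡ g (e ∸v a)
mono*s-≤ a e g le = begin
    (mono a *s g) e
  ≡⟨ *s-sumBelow (mono a) g e ⟩
    sumBelow e (λ b → mono a b *ℤ g (e ∸v b))
  ≡⟨ sumBelow-single e a le (λ b _ ne → trans (cong (_*ℤ g (e ∸v b)) (mono-≢ a b (ne ∘ sym))) (ℤP.*-zeroˡ (g (e ∸v b)))) ⟩
    mono a a *ℤ g (e ∸v a)
  ≡⟨ trans (cong (_*ℤ g (e ∸v a)) (mono-refl a)) (ℤP.*-identityˡ _) ⟩
    g (e ∸v a) ∎
  where open ≡-Reasoning

mono*s-≰ : ∀ {m} (a e : Exp m) (g : Series m) → ¬ (a ≤v e) → (mono a *s g) e ≡ 0ℤ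
mono*s-≰ a e g nle = trans (*s-sumBelow (mono a) g e)
  (sumBelow-zero e (λ b le → trans (cong (_*ℤ g (e ∸v b)) (mono-≢ a b (λ a≡b → nle (subst (_≤v e) (sym a≡b) le))))
                                   (ℤP.*-zeroˡ (g (e ∸v b)))))

*s-mono-≤ : ∀ {m} (c e : Exp m) (f : Series m) → c ≤v e → (f *s mono c) e ≡ f (e ∸v c)
*s-mono-≤ c e f le = begin
    (f *s mono c) e
  ≡⟨ *s-sumBelow f (mono c) e ⟩
    sumBelow e (λ b → f b *ℤ mono c (e ∸v b))
  ≡⟨ sumBelow-single e (e ∸v c) (∸v-≤v e c) (λ b lb ne → trans (cong (f b *ℤ_) (mono-≢ c (e ∸v b)
        (λ c≡ → ne (trans (sym (∸v-∸v e b lb)) (cong (e ∸v_) (sym c≡)))))) (ℤP.*-zeroʳ (f b))) ⟩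
    f (e ∸v c) *ℤ mono c (e ∸v (e ∸v c))
  ≡⟨ cong (λ z → f (e ∸v c) *ℤ mono c z) (∸v-∸v e c le) ⟩
    f (e ∸v c) *ℤ mono c c
  ≡⟨ trans (cong (f (e ∸v c) *ℤ_) (mono-refl c)) (ℤP.*-identityʳ _) ⟩
    f (e ∸v c) ∎
  where open ≡-Reasoning

*s-sumUp : ∀ {m} (f g : Series m) e K (F : ℕ → Series m) →
  (∀ b → b ≤v e → f b ≡ sumUp K (λ t → F t b)) → (f *s g) e ≡ sumUp K (λ t → (F t *s g) e)
*s-sumUp f g e K F eq = begin
    (f *s g) e
  ≡⟨ *s-sumBelow f g e ⟩
    sumBelow e (λ b → f b *ℤ g (e ∸v b))
  ≡⟨ sumBelow-cong e (λ b le → trans (cong (_*ℤ g (e ∸v b)) (eq b le)) (sumUp-*ʳ K (λ t → F t b) (g (e ∸v b)))) ⟩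
    sumBelow e (λ b → sumUp K (λ t → F t b *ℤ g (e ∸v b)))
  ≡⟨ sumBelow-sumUp e K (λ t b → F t b *ℤ g (e ∸v b)) ⟩
    sumUp K (λ t → sumBelow e (λ b → F t b *ℤ g (e ∸v b)))
  ≡⟨ sumUp-cong K (λ t _ → sym (*s-sumBelow (F t) g e)) ⟩
    sumUp K (λ t → (F t *s g) e) ∎
  where open ≡-Reasoning

sumS-map : ∀ {m} {A : Set} (h : A → Series m) (L : List A) b → sumS (map h L) b ≡ sumℤ (map (λ x → h x b) L)
sumS-map h [] b = refl
sumS-map h (x ∷ L) b = cong (h x b +ℤ_) (sumS-map h L b)

sumS-apply : ∀ {m} (fs : List (Series m)) b → sumS fs b ≡ sumℤ (map (λ f → f b) fs)
sumS-apply [] b = refl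
sumS-apply (f ∷ fs) b = cong (f b +ℤ_) (sumS-apply fs b)

qint-sumUp : ∀ {m} (i : Fin m) K (b : Exp m) → qint i K b ≡ sumUp K (λ t → mono (scaleE t (unitE i)) b)
qint-sumUp i K b = trans (sumS-map (λ a → mono (scaleE a (unitE i))) (upTo K) b) (sumℤ-upTo _ K)

mono-scaleE-beyond-head : ∀ {m} (a b : Exp (suc m)) → 1 ≤ Vec.head a → ∀ t → Vec.head b < t →
  mono (scaleE t a) b ≡ 0ℤ
mono-scaleE-beyond-head (a0 ∷ a) (b0 ∷ b) 1≤a0 t b0<t = mono-≢ (scaleE t (a0 ∷ a)) (b0 ∷ b) (λ eq → ℕP.<-irrefl refl
   (ℕP.<-≤-trans b0<t (subst (t ≤_) (cong Vec.head eq) (subst (_≤ t * a0) (ℕP.*-identityʳ t) (ℕP.*-monoʳ-≤ t 1≤a0)))))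

geomInv-sumUp : ∀ {m} (a b : Exp (suc m)) B → 1 ≤ Vec.head a → Vec.head b ≤ B →
  geomInv a b ≡ sumUp (suc B) (λ t → mono (scaleE t a) b)
geomInv-sumUp a b@(b0 ∷ bs) B 1≤a0 b0≤B = begin
    geomInv a b
  ≡⟨ sumℤ-upTo (λ t → mono (scaleE t a) b) (suc (Vec.sum b)) ⟩
    sumUp (suc (Vec.sum b)) (λ t → mono (scaleE t a) b)
  ≡⟨ sumUp-extend (suc b0) (suc (Vec.sum b)) (s≤s (ℕP.m≤m+n b0 _)) (λ t l _ → mono-scaleE-beyond-head a b 1≤a0 t l) ⟩
    sumUp (suc b0) (λ t → mono (scaleE t a) b)
  ≡⟨ sym (sumUp-extend (suc b0) (suc B) (s≤s b0≤B) (λ t l _ → mono-scaleE-beyond-head a b 1≤a0 t l)) ⟩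
    sumUp (suc B) (λ t → mono (scaleE t a) b) ∎
  where open ≡-Reasoning

geomInv*s-sumUp : ∀ {m} (a e : Exp (suc m)) (g : Series (suc m)) → 1 ≤ Vec.head a →
  (geomInv a *s g) e ≡ sumUp (suc (lookup e zero)) (λ t → (mono (scaleE t a) *s g) e)
geomInv*s-sumUp a e@(e0 ∷ _) g 1≤a0 = *s-sumUp (geomInv a) g e (suc e0) (λ t → mono (scaleE t a))
  (λ { b@(_ ∷ _) (b0≤e0 ∷ _) → geomInv-sumUp a b e0 1≤a0 b0≤e0 })

qint*s-sumUp : ∀ {m} i K (e : Exp m) (g : Series m) →
  (qint i K *s g) e ≡ sumUp K (λ t → (mono (scaleE t (unitE i)) *s g) e)
qint*s-sumUp i K e g = *s-sumUp (qint i K) g e K (λ t → mono (scaleE t (unitE i))) (λ b _ → qint-sumUp i K b)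

Iverson : Set → ℤ → Set
Iverson P v = (P → v ≡ 1ℤ) × (¬ P → v ≡ 0ℤ)

Iverson-⇔ : ∀ {P Q : Set} {v} → (P → Q) → (Q → P) → Iverson P v → Iverson Q v
Iverson-⇔ f g (yes₁ , no₀) = (λ q → yes₁ (g q)) , (λ ¬q → no₀ (¬q ∘ f))

Iverson-unique : ∀ {P : Set} {v w : ℤ} → Dec P → Iverson P v → Iverson P w → v ≡ w
Iverson-unique (yes p) (v≡1 , _) (w≡1 , _) = trans (v≡1 p) (sym (w≡1 p))
Iverson-unique (no ¬p) (_ , v≡0) (_ , w≡0) = trans (v≡0 ¬p) (sym (w≡0 ¬p))

record UniqueBelow (K : ℕ) (Q : ℕ → Set) : Set where
  field
    witness   : ℕ
    witness<K : witness < K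
    holds     : Q witness
    unique    : ∀ t → t < K → Q t → t ≡ witness

Iverson-sumUp : ∀ K (Q : ℕ → Set) (f : ℕ → ℤ) → (∀ t → t < K → Iverson (Q t) (f t)) →
  (P : Set) → (P → UniqueBelow K Q) → (∀ t → t < K → Q t → P) → Iverson P (sumUp K f)
Iverson-sumUp K Q f f≡[Q] P unique-of witness-of = sum≡1 , sum≡0
  where
  sum≡1 : P → sumUp K f ≡ 1ℤ
  sum≡1 p = trans (sumUp-single K witness witness<K others) (proj₁ (f≡[Q] witness witness<K) holds)
    where
    open UniqueBelow (unique-of p)
    others : ∀ t → t < K → t ≢ witness → f t ≡ 0ℤ
    others t t<K t≢w = proj₂ (f≡[Q] t t<K) (t≢w ∘ unique t t<K)
  sum≡0 : ¬ P → sumUp K f ≡ 0ℤ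
  sum≡0 ¬p = sumUp-zero K (λ t t<K → proj₂ (f≡[Q] t t<K) (¬p ∘ witness-of t t<K))

Iverson-mono*s : ∀ {m} (G : Series m) (Q : Exp m → Set) → (∀ y → Iverson (Q y) (G y)) →
  ∀ a y → Iverson (a ≤v y × Q (y ∸v a)) ((mono a *s G) y)
Iverson-mono*s G Q G≡[Q] a y with a ≤v? y
... | yes a≤y = (λ { (_ , q) → trans (mono*s-≤ a y G a≤y) (proj₁ (G≡[Q] _) q) })
              , (λ ¬q → trans (mono*s-≤ a y G a≤y) (proj₂ (G≡[Q] _) (λ q → ¬q (a≤y , q))))
... | no a≰y = (λ { (a≤y , _) → ⊥-elim (a≰y a≤y) }) , (λ _ → mono*s-≰ a y G a≰y)

record UniqueShift {m} (K : ℕ) (v : ℕ → Exp m) (y : Exp m) (Q : Exp m → Set) : Set where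
  field
    t*   : ℕ
    t*<K : t* < K
    le*  : v t* ≤v y
    q*   : Q (y ∸v v t*)
    uniq : ∀ t → t < K → v t ≤v y → Q (y ∸v v t) → t ≡ t*

Iverson-sumUp-shift : ∀ {m} (G : Series m) (Q : Exp m → Set) → (∀ y' → Iverson (Q y') (G y')) →
  (P : Set) (y : Exp m) (K : ℕ) (v : ℕ → Exp m) →
  (P → UniqueShift K v y Q) → (∀ t → t < K → v t ≤v y → Q (y ∸v v t) → P) →
  Iverson P (sumUp K (λ t → (mono (v t) *s G) y))
Iverson-sumUp-shift G Q G≡[Q] P y K v unique-of witness-of =
  Iverson-sumUp K (λ t → v t ≤v y × Q (y ∸v v t)) (λ t → (mono (v t) *s G) y)
    (λ t _ → Iverson-mono*s G Q G≡[Q] (v t) y) P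
    (λ p → let open UniqueShift (unique-of p) in
           record { witness = t* ; witness<K = t*<K ; holds = le* , q* ; unique = λ t t<K (le , q) → uniq t t<K le q })
    (λ t t<K (le , q) → witness-of t t<K le q)

true≢false : true ≢ false
true≢false ()

≢true⇒≡false : ∀ {b} → b ≢ true → b ≡ false
≢true⇒≡false {true} ne = ⊥-elim (ne refl)
≢true⇒≡false {false} _ = refl

∨-split : ∀ a b → a ∨ b ≡ true → a ≡ true ⊎ b ≡ true
∨-split true b _ = inj₁ refl
∨-split false b h = inj₂ h

∨-false : ∀ a b → a ∨ b ≡ false → a ≡ false × b ≡ false
∨-false false false _ = refl , refl

memB-here : ∀ {n} (j : Fin n) l → memB j (j ∷ l) ≡ true
memB-here j l with j Fin.≟ j
... | yes _ = refl
... | no ne = ⊥-elim (ne refl)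

memB-there : ∀ {n} (i j : Fin n) l → memB i l ≡ true → memB i (j ∷ l) ≡ true
memB-there i j l h with i Fin.≟ j
... | yes _ = refl
... | no _ = h

memB-≢ : ∀ {n} (i j : Fin n) l → i ≢ j → memB i (j ∷ l) ≡ memB i l
memB-≢ i j l ne with i Fin.≟ j
... | yes e = ⊥-elim (ne e)
... | no _ = refl

memB-false⇒≢ : ∀ {n} (i j : Fin n) l → memB i (j ∷ l) ≡ false → i ≢ j
memB-false⇒≢ i j l h refl with () ← trans (sym (memB-here i l)) h

memB-false-tail : ∀ {n} (i j : Fin n) l → memB i (j ∷ l) ≡ false → memB i l ≡ false
memB-false-tail i j l h = trans (sym (memB-≢ i j l (memB-false⇒≢ i j l h))) h

memB-∷-true : ∀ {n} (i j : Fin n) l → memB i (j ∷ l) ≡ true → (i ≡ j) ⊎ (memB i l ≡ true)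
memB-∷-true i j l h with i Fin.≟ j
... | yes e = inj₁ e
... | no _ = inj₂ h

memB-singleton : ∀ {n} (i j : Fin n) → memB i [ j ] ≡ true → i ≡ j
memB-singleton i j h with i Fin.≟ j
... | yes e = e

distinctB-head : ∀ {n} (j : Fin n) l → distinctB (j ∷ l) ≡ true → memB j l ≡ false
distinctB-head j l h with memB j l | h
... | false | _ = refl

distinctB-tail : ∀ {n} (j : Fin n) l → distinctB (j ∷ l) ≡ true → distinctB l ≡ true
distinctB-tail j l h with memB j l | h
... | false | d = d

memB-++ : ∀ {n} (c : Fin n) A B → memB c (A ++ B) ≡ memB c A ∨ memB c B
memB-++ c [] B = refl
memB-++ c (a ∷ A) B rewrite memB-++ c A B = sym (BP.∨-assoc (does (c Fin.≟ a)) (memB c A) (memB c B))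

memB-tabulate : ∀ {n m} (f : Fin m → Fin n) i → memB (f i) (List.tabulate f) ≡ true
memB-tabulate {m = suc m} f zero = memB-here (f zero) (List.tabulate (f ∘ suc))
memB-tabulate {m = suc m} f (suc i) =
  memB-there (f (suc i)) (f zero) (List.tabulate (f ∘ suc)) (memB-tabulate (f ∘ suc) i)

memB-tabulate⁻ : ∀ {n m} (f : Fin m → Fin n) x → memB x (List.tabulate f) ≡ true → ∃ (λ i → x ≡ f i)
memB-tabulate⁻ {m = suc m} f x h with memB-∷-true x (f zero) (List.tabulate (f ∘ suc)) h
... | inj₁ e = zero , e
... | inj₂ h' with memB-tabulate⁻ (f ∘ suc) x h'
... | i , e = suc i , e

distinctB-tabulate : ∀ {n m} (f : Fin m → Fin n) → (∀ i j → f i ≡ f j → i ≡ j) → distinctB (List.tabulate f) ≡ true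
distinctB-tabulate {m = zero} f inj = refl
distinctB-tabulate {m = suc m} f inj with memB (f zero) (List.tabulate (f ∘ suc)) in eq
... | true with memB-tabulate⁻ (f ∘ suc) (f zero) eq
...   | i , e with () ← inj _ _ e
distinctB-tabulate {m = suc m} f inj | false = distinctB-tabulate (f ∘ suc) (λ i j e → FinP.suc-injective (inj _ _ e))

memB-allFin : ∀ {n} (i : Fin n) → memB i (List.allFin n) ≡ true
memB-allFin {n} i = memB-tabulate {n} id i

distinctB-allFin : ∀ n → distinctB (List.allFin n) ≡ true
distinctB-allFin n = distinctB-tabulate {n} id (λ i j e → e)

-- The left-hand side

module _ (n : ℕ) where

  InBox : ℕ → List (Fin n) → Exp (suc n) → Set
  InBox K js y = (lookup y zero ≡ 0) × (∀ i → memB i js ≡ true → lookup y (suc i) < K)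
                 × (∀ i → memB i js ≡ false → lookup y (suc i) ≡ 0)

  powE : ℕ → Fin n → Exp (suc n)
  powE t j = scaleE t (unitE (suc j))

  lookup-powE-self : ∀ t j → lookup (powE t j) (suc j) ≡ t
  lookup-powE-self t j = trans (lookup-scaleE t (unitE {suc n} (suc j)) (suc j))
                               (trans (cong (t *_) (lookup-unitE-≡ (suc j))) (ℕP.*-identityʳ t))

  lookup-powE-other : ∀ t j i → i ≢ suc j → lookup (powE t j) i ≡ 0
  lookup-powE-other t j i ne = trans (lookup-scaleE t (unitE {suc n} (suc j)) i)
                                     (trans (cong (t *_) (lookup-unitE-≢ (suc j) i ne)) (ℕP.*-zeroʳ t))

  lookup-∸powE-self : ∀ y t j → lookup (y ∸v powE t j) (suc j) ≡ lookup y (suc j) ∸ t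
  lookup-∸powE-self y t j = trans (lookup-∸v y (powE t j) (suc j)) (cong (lookup y (suc j) ∸_) (lookup-powE-self t j))

  lookup-∸powE-other : ∀ y t j i → i ≢ suc j → lookup (y ∸v powE t j) i ≡ lookup y i
  lookup-∸powE-other y t j i ne =
    trans (lookup-∸v y (powE t j) i) (cong (lookup y i ∸_) (lookup-powE-other t j i ne))

  powE-≤v : ∀ y t j → t ≤ lookup y (suc j) → powE t j ≤v y
  powE-≤v y t j le = ≤v-from-lookup (powE t j) y bound
    where
    bound : ∀ i → lookup (powE t j) i ≤ lookup y i
    bound i with i Fin.≟ suc j
    ... | yes refl = subst (_≤ lookup y i) (sym (lookup-powE-self t j)) le
    ... | no ne = subst (_≤ lookup y i) (sym (lookup-powE-other t j i ne)) z≤n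

  powE-≤v⁻ : ∀ y t j → powE t j ≤v y → t ≤ lookup y (suc j)
  powE-≤v⁻ y t j le = subst (_≤ lookup y (suc j)) (lookup-powE-self t j) (Pw.lookup le (suc j))

  qintProd : ℕ → List (Fin n) → Series (suc n)
  qintProd K js = prodS (map (λ j → qint (suc j) K) js)

  qintProd-Iverson : ∀ K (js : List (Fin n)) → distinctB js ≡ true → ∀ y → Iverson (InBox K js y) (qintProd K js y)
  qintProd-Iverson K [] _ y =
      (λ p → 1s-zeroE y (≡-from-lookup y zeroE (λ { zero → trans (proj₁ p) (sym (lookup-zeroE {suc n} zero))
                                                   ; (suc i) → trans (proj₂ (proj₂ p) i refl)
                                                       (sym (lookup-zeroE {suc n} (suc i))) })))
    , (λ ¬p → 1s-≢zeroE y (λ { refl → ¬p (lookup-zeroE {suc n} zero , (λ i ()) , (λ i _ → lookup-zeroE {suc n} (suc i))) }))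
  qintProd-Iverson K (j ∷ js) dj y =
    subst (Iverson (InBox K (j ∷ js) y)) (sym (qint*s-sumUp (suc j) K y (qintProd K js)))
      (Iverson-sumUp-shift (qintProd K js) (InBox K js) (qintProd-Iverson K js (distinctB-tail j js dj))
        (InBox K (j ∷ js) y) y K (λ t → powE t j) unique-of witness-of)
    where
    j∉js : memB j js ≡ false
    j∉js = distinctB-head j js dj
    yj = lookup y (suc j)
    other : ∀ {i : Fin n} → i ≢ j → suc i ≢ suc j
    other ne = ne ∘ FinP.suc-injective
    forced : ∀ t → powE t j ≤v y → InBox K js (y ∸v powE t j) → t ≡ yj
    forced t le p = ℕP.≤-antisym (powE-≤v⁻ y t j le)
      (ℕP.m∸n≡0⇒m≤n (trans (sym (lookup-∸powE-self y t j)) (proj₂ (proj₂ p) j j∉js)))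
    witness-of : ∀ t → t < K → powE t j ≤v y → InBox K js (y ∸v powE t j) → InBox K (j ∷ js) y
    witness-of t t<K le p@(p₀ , p< , p₌) =
        trans (sym (lookup-∸powE-other y t j zero (λ ()))) p₀
      , (λ i i∈ → under i i∈)
      , (λ i i∉ → trans (sym (lookup-∸powE-other y t j (suc i) (other (memB-false⇒≢ i j js i∉))))
                        (p₌ i (memB-false-tail i j js i∉)))
      where
      under : ∀ i → memB i (j ∷ js) ≡ true → lookup y (suc i) < K
      under i i∈ with i Fin.≟ j
      ... | yes refl = subst (_< K) (forced t le p) t<K
      ... | no ne = subst (_< K) (lookup-∸powE-other y t j (suc i) (other ne)) (p< i i∈)
    unique-of : InBox K (j ∷ js) y → UniqueShift K (λ t → powE t j) y (InBox K js)
    unique-of (p₀ , p< , p₌) = record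
      { t* = yj ; t*<K = p< j (memB-here j js) ; le* = powE-≤v y yj j ℕP.≤-refl
      ; q* = trans (lookup-∸powE-other y yj j zero (λ ())) p₀ , rest< , rest₌
      ; uniq = λ t _ le p → forced t le p }
      where
      rest< : ∀ i → memB i js ≡ true → lookup (y ∸v powE yj j) (suc i) < K
      rest< i i∈ with i Fin.≟ j
      ... | yes refl with () ← trans (sym j∉js) i∈
      ... | no ne = subst (_< K) (sym (lookup-∸powE-other y yj j (suc i) (other ne))) (p< i (trans (memB-≢ i j js ne) i∈))
      rest₌ : ∀ i → memB i js ≡ false → lookup (y ∸v powE yj j) (suc i) ≡ 0
      rest₌ i i∉ with i Fin.≟ j
      ... | yes refl = trans (lookup-∸powE-self y yj i) (ℕP.n∸n≡0 yj)
      ... | no ne = trans (lookup-∸powE-other y yj j (suc i) (other ne)) (p₌ i (trans (memB-≢ i j js ne) i∉))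

LHS-Iverson : ∀ n e0 (x : Vec ℕ n) → Iverson (∀ i → lookup x i ≤ e0) (LHS n (e0 ∷ x))
LHS-Iverson n e0 x =
  subst (Iverson _) (sym (sumℤ-upTo (λ k → lhsTerm n k e) (suc e0)))
    (Iverson-sumUp (suc e0) (λ k → InBox n (suc k) all (y k)) (λ k → lhsTerm n k e)
      (λ { k (s≤s k≤e0) → subst (Iverson _) (sym (*s-mono-≤ (k ∷ zeroE) e (qintProd n (suc k) all) (k≤e0 ∷ zeroE-≤v x)))
                             (qintProd-Iverson n (suc k) all (distinctB-allFin n) (y k)) })
      (∀ i → lookup x i ≤ e0) unique-of witness-of)
  where
  e = e0 ∷ x
  all = List.allFin n
  y : ℕ → Exp (suc n)
  y k = e ∸v (k ∷ zeroE)
  lookup-y : ∀ k i → lookup (y k) (suc i) ≡ lookup x i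
  lookup-y k i = trans (lookup-∸v x zeroE i) (cong (lookup x i ∸_) (lookup-zeroE i))
  forced : ∀ k → k < suc e0 → InBox n (suc k) all (y k) → k ≡ e0
  forced k (s≤s k≤e0) p = ℕP.≤-antisym k≤e0 (ℕP.m∸n≡0⇒m≤n (proj₁ p))
  unique-of : (∀ i → lookup x i ≤ e0) → UniqueBelow (suc e0) (λ k → InBox n (suc k) all (y k))
  unique-of x≤e0 = record
    { witness = e0 ; witness<K = ℕP.≤-refl
    ; holds = ℕP.n∸n≡0 e0 , (λ i _ → s≤s (subst (_≤ e0) (sym (lookup-y e0 i)) (x≤e0 i)))
            , (λ i i∉ → ⊥-elim (true≢false (trans (sym (memB-allFin i)) i∉)))
    ; unique = forced }
  witness-of : ∀ k → k < suc e0 → InBox n (suc k) all (y k) → ∀ i → lookup x i ≤ e0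
  witness-of k k<e0+1 p i = subst (lookup x i ≤_) (forced k k<e0+1 p)
    (ℕP.≤-pred (subst (_< suc k) (lookup-y k i) (proj₁ (proj₂ p) i (memB-allFin i))))

-- Products of geometric series along a chain of prefixes

module Chains (n r' : ℕ) where
  r : ℕ
  r = suc r'

  prefixE : List (Fin n) → Exp (suc n)
  prefixE A = 1 ∷ tabulate (λ i → if memB i A then 1 else 0)

  rPrefixE : List (Fin n) → Exp (suc n)
  rPrefixE A = scaleE r (prefixE A)

  chainExps : List (Fin n) → List (Fin n) → List (Exp (suc n))
  chainExps A [] = [ rPrefixE A ]
  chainExps A (b ∷ B) = rPrefixE A ∷ chainExps (A ++ [ b ]) B

  chainSeries : List (Fin n) → List (Fin n) → Series (suc n)
  chainSeries A B = prodS (map geomInv (chainExps A B))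

  RChain : ℕ → List (Fin n) → Exp (suc n) → Set
  RChain h [] y = ∃ λ t → h ≡ r * t
  RChain h (b ∷ B) y = (∃ λ t → h ≡ lookup y (suc b) + r * t) × RChain (lookup y (suc b)) B y

  ChainSupport : List (Fin n) → List (Fin n) → Exp (suc n) → Set
  ChainSupport A B y = (∀ c → memB c A ≡ true → lookup y (suc c) ≡ lookup y zero) × RChain (lookup y zero) B y

  RChain-cong : ∀ h B y y' → (∀ c → memB c B ≡ true → lookup y' (suc c) ≡ lookup y (suc c)) → RChain h B y → RChain h B y'
  RChain-cong h [] y y' eq ch = ch
  RChain-cong h (b ∷ B) y y' eq ((t , e) , ch) =
    (t , trans e (cong (_+ r * t) (sym eqb))) , RChain-cong (lookup y' (suc b)) B y y' (λ c m → eq c (memB-there c b B m))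
      (subst (λ z → RChain z B y) (sym eqb) ch)
    where eqb = eq b (memB-here b B)

  stepE : List (Fin n) → ℕ → Exp (suc n)
  stepE A t = scaleE t (rPrefixE A)

  lookup-stepE-zero : ∀ A t → lookup (stepE A t) zero ≡ r * t
  lookup-stepE-zero A t = trans (ℕP.*-comm t (r * 1)) (cong (_* t) (ℕP.*-identityʳ r))

  lookup-prefixE : ∀ A c → lookup (prefixE A) (suc c) ≡ (if memB c A then 1 else 0)
  lookup-prefixE A c = VP.lookup∘tabulate (λ i → if memB i A then 1 else 0) c

  lookup-stepE-∈ : ∀ A t c → memB c A ≡ true → lookup (stepE A t) (suc c) ≡ r * t
  lookup-stepE-∈ A t c m rewrite lookup-scaleE t (rPrefixE A) (suc c) | lookup-scaleE r (prefixE A)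
      (suc c) | lookup-prefixE A c | m =
    trans (ℕP.*-comm t (r * 1)) (cong (_* t) (ℕP.*-identityʳ r))

  lookup-stepE-∉ : ∀ A t c → memB c A ≡ false → lookup (stepE A t) (suc c) ≡ 0
  lookup-stepE-∉ A t c m rewrite lookup-scaleE t (rPrefixE A) (suc c) | lookup-scaleE r (prefixE A)
      (suc c) | lookup-prefixE A c | m =
    trans (cong (t *_) (ℕP.*-zeroʳ r)) (ℕP.*-zeroʳ t)

  lookup-∸stepE-zero : ∀ A t y → lookup (y ∸v stepE A t) zero ≡ lookup y zero ∸ r * t
  lookup-∸stepE-zero A t y = trans (lookup-∸v y (stepE A t) zero) (cong (lookup y zero ∸_) (lookup-stepE-zero A t))

  lookup-∸stepE-∈ : ∀ A t y c → memB c A ≡ true → lookup (y ∸v stepE A t) (suc c) ≡ lookup y (suc c) ∸ r * t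
  lookup-∸stepE-∈ A t y c m = trans (lookup-∸v y (stepE A t) (suc c)) (cong (lookup y (suc c) ∸_) (lookup-stepE-∈ A t c m))

  lookup-∸stepE-∉ : ∀ A t y c → memB c A ≡ false → lookup (y ∸v stepE A t) (suc c) ≡ lookup y (suc c)
  lookup-∸stepE-∉ A t y c m = trans (lookup-∸v y (stepE A t) (suc c)) (cong (lookup y (suc c) ∸_) (lookup-stepE-∉ A t c m))

  stepE-≤v : ∀ A t y → r * t ≤ lookup y zero → (∀ c → memB c A ≡ true → r * t ≤ lookup y (suc c)) → stepE A t ≤v y
  stepE-≤v A t y h0 hc = ≤v-from-lookup (stepE A t) y f
    where
    f : ∀ i → lookup (stepE A t) i ≤ lookup y i
    f zero = subst (_≤ lookup y zero) (sym (lookup-stepE-zero A t)) h0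
    f (suc c) with memB c A in eq
    ... | true = subst (_≤ lookup y (suc c)) (sym (lookup-stepE-∈ A t c eq)) (hc c eq)
    ... | false = subst (_≤ lookup y (suc c)) (sym (lookup-stepE-∉ A t c eq)) z≤n

  stepE-≤v⁻-zero : ∀ A t y → stepE A t ≤v y → r * t ≤ lookup y zero
  stepE-≤v⁻-zero A t y le = subst (_≤ lookup y zero) (lookup-stepE-zero A t) (Pw.lookup le zero)

  stepE-≤v⁻-∈ : ∀ A t y c → memB c A ≡ true → stepE A t ≤v y → r * t ≤ lookup y (suc c)
  stepE-≤v⁻-∈ A t y c m le = subst (_≤ lookup y (suc c)) (lookup-stepE-∈ A t c m) (Pw.lookup le (suc c))

  r*-injective : ∀ {t t'} → r * t ≡ r * t' → t ≡ t'
  r*-injective {t} {t'} e = ℕP.*-cancelˡ-≡ t t' r e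

  ∸≡⇒≡+ : ∀ {a s b} → a ∸ s ≡ b → s ≤ a → a ≡ b + s
  ∸≡⇒≡+ {a} {s} refl le = sym (ℕP.m∸n+n≡m le)

  rPrefixE-head-positive : ∀ A → 1 ≤ Vec.head (rPrefixE A)
  rPrefixE-head-positive A = s≤s z≤n

  Complementary : List (Fin n) → List (Fin n) → Set
  Complementary A B = (∀ c → memB c A ≡ true → memB c B ≡ false) × distinctB B ≡ true ×
      (∀ c → memB c A ≡ false → memB c B ≡ true)

  complementary-head∉ : ∀ A b B → Complementary A (b ∷ B) → memB b A ≡ false
  complementary-head∉ A b B (disj , _ , _) = ≢true⇒≡false (λ m → true≢false (trans (sym (memB-here b B)) (disj b m)))

  complementary-tail∉ : ∀ A b B → Complementary A (b ∷ B) → ∀ c → memB c B ≡ true → memB c A ≡ false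
  complementary-tail∉ A b B (disj , _ , _) c m = ≢true⇒≡false
      (λ m' → true≢false (trans (sym (memB-there c b B m)) (disj c m')))

  complementary-step : ∀ A b B → Complementary A (b ∷ B) → Complementary (A ++ [ b ]) B
  complementary-step A b B (disj , dB , cover) =
      (λ c m → disjoint (∨-split _ _ (trans (sym (memB-++ c A [ b ])) m)))
    , distinctB-tail b B dB
    , (λ c m → let (c∉A , c∉[b]) = ∨-false _ _ (trans (sym (memB-++ c A [ b ])) m)
               in trans (sym (memB-≢ c b B (memB-false⇒≢ c b [] c∉[b]))) (cover c c∉A))
    where
    disjoint : ∀ {c} → memB c A ≡ true ⊎ memB c [ b ] ≡ true → memB c B ≡ false
    disjoint {c} (inj₁ m) = memB-false-tail c b B (disj c m)
    disjoint {c} (inj₂ m) with memB-singleton c b m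
    ... | refl = distinctB-head b B dB

  chainSeries-sumUp : ∀ A B y → chainSeries A B y ≡ sumUp (suc (lookup y zero))
      (λ t → (mono (stepE A t) *s prodS (map geomInv (List.drop 1 (chainExps A B)))) y)
  chainSeries-sumUp A [] y = geomInv*s-sumUp (rPrefixE A) y 1s (rPrefixE-head-positive A)
  chainSeries-sumUp A (b ∷ B) y = geomInv*s-sumUp (rPrefixE A) y (chainSeries (A ++ [ b ]) B) (rPrefixE-head-positive A)

  chainSeries-Iverson-[] : ∀ A → Complementary A [] → ∀ y → Iverson (ChainSupport A [] y) (chainSeries A [] y)
  chainSeries-Iverson-[] A (disj , _ , cover) y = subst (Iverson (ChainSupport A [] y)) (sym (chainSeries-sumUp A [] y))
      (Iverson-sumUp-shift 1s (λ y' → y' ≡ zeroE) (λ y' → 1s-zeroE y' , 1s-≢zeroE y') (ChainSupport A [] y) y K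
          (stepE A) unique-of witness-of)
    where
    K = suc (lookup y zero)
    inA : ∀ c → memB c A ≡ true
    inA c with memB c A in eq
    ... | true = refl
    ... | false = ⊥-elim (true≢false (sym (cover c eq)))
    unique-of : ChainSupport A [] y → UniqueShift K (stepE A) y (λ y' → y' ≡ zeroE)
    unique-of (hA , (t* , eq*)) = record
      { t* = t* ; t*<K = s≤s (ℕP.≤-trans (ℕP.m≤n*m t* r) r≤) ; le* = stepE-≤v A t* y r≤
          (λ c m → subst (r * t* ≤_) (sym (hA c m)) r≤)
      ; q* = ≡-from-lookup _ zeroE q ; uniq = un }
      where
      r≤ : r * t* ≤ lookup y zero
      r≤ = ℕP.≤-reflexive (sym eq*)
      q : ∀ i → lookup (y ∸v stepE A t*) i ≡ lookup (zeroE {suc n}) i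
      q zero = trans (lookup-∸stepE-zero A t* y) (trans (cong (_∸ r * t*) eq*)
          (trans (ℕP.n∸n≡0 (r * t*)) (sym (lookup-zeroE {suc n} zero))))
      q (suc c) = trans (lookup-∸stepE-∈ A t* y c (inA c))
          (trans (cong (_∸ r * t*) (trans (hA c (inA c)) eq*))
              (trans (ℕP.n∸n≡0 (r * t*)) (sym (lookup-zeroE {suc n} (suc c)))))
      un : ∀ t → t < K → stepE A t ≤v y → y ∸v stepE A t ≡ zeroE → t ≡ t*
      un t _ le z = r*-injective (trans (sym (ℕP.≤-antisym
          (ℕP.m∸n≡0⇒m≤n (trans (sym (lookup-∸stepE-zero A t y))
              (trans (cong (λ w → lookup w zero) z) (lookup-zeroE {suc n} zero)))) (stepE-≤v⁻-zero A t y le))) eq*)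
    witness-of : ∀ t → t < K → stepE A t ≤v y → y ∸v stepE A t ≡ zeroE → ChainSupport A [] y
    witness-of t _ le z = (λ c m → trans (yc c m) (sym y0)) , (t , y0)
      where
      y0 : lookup y zero ≡ r * t
      y0 = ℕP.≤-antisym (ℕP.m∸n≡0⇒m≤n (trans (sym (lookup-∸stepE-zero A t y))
          (trans (cong (λ w → lookup w zero) z) (lookup-zeroE {suc n} zero)))) (stepE-≤v⁻-zero A t y le)
      yc : ∀ c → memB c A ≡ true → lookup y (suc c) ≡ r * t
      yc c m = ℕP.≤-antisym (ℕP.m∸n≡0⇒m≤n (trans (sym (lookup-∸stepE-∈ A t y c m))
          (trans (cong (λ w → lookup w (suc c)) z) (lookup-zeroE {suc n} (suc c))))) (stepE-≤v⁻-∈ A t y c m le)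
  chainSeries-Iverson-∷ : ∀ A b B → Complementary A (b ∷ B) →
    (∀ y → Iverson (ChainSupport (A ++ [ b ]) B y) (chainSeries (A ++ [ b ]) B y)) →
    ∀ y → Iverson (ChainSupport A (b ∷ B) y) (chainSeries A (b ∷ B) y)
  chainSeries-Iverson-∷ A b B (disj , dB , cover) IH y = subst (Iverson (ChainSupport A (b ∷ B) y))
      (sym (chainSeries-sumUp A (b ∷ B) y))
      (Iverson-sumUp-shift (chainSeries A' B) (ChainSupport A' B) IH (ChainSupport A (b ∷ B) y) y K
          (stepE A) unique-of witness-of)
    where
    A' = A ++ [ b ]
    K = suc (lookup y zero)
    bnA : memB b A ≡ false
    bnA = complementary-head∉ A b B (disj , dB , cover)
    BnA : ∀ c → memB c B ≡ true → memB c A ≡ false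
    BnA = complementary-tail∉ A b B (disj , dB , cover)
    yb = lookup y (suc b)
    y0 = lookup y zero
    bA' : memB b A' ≡ true
    bA' = trans (memB-++ b A [ b ]) (subst (λ z → z ∨ memB b [ b ] ≡ true) (sym bnA) (memB-here b []))
    unique-of : ChainSupport A (b ∷ B) y → UniqueShift K (stepE A) y (ChainSupport A' B)
    unique-of (hA , ((t* , eq*) , ch)) = record
      { t* = t* ; t*<K = s≤s (ℕP.≤-trans (ℕP.m≤n*m t* r) r≤) ; le* = stepE-≤v A t* y r≤
          (λ c m → subst (r * t* ≤_) (sym (hA c m)) r≤)
      ; q* = q1 , q2 ; uniq = un }
      where
      r≤ : r * t* ≤ y0
      r≤ = subst (r * t* ≤_) (sym eq*) (ℕP.m≤n+m (r * t*) yb)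
      y'0≡ : lookup (y ∸v stepE A t*) zero ≡ yb
      y'0≡ = trans (lookup-∸stepE-zero A t* y) (trans (cong (_∸ r * t*) eq*) (ℕP.m+n∸n≡m yb (r * t*)))
      q1 : ∀ c → memB c A' ≡ true → lookup (y ∸v stepE A t*) (suc c) ≡ lookup (y ∸v stepE A t*) zero
      q1 c m with ∨-split _ _ (trans (sym (memB-++ c A [ b ])) m)
      ... | inj₁ mA = trans (lookup-∸stepE-∈ A t* y c mA)
          (trans (cong (_∸ r * t*) (hA c mA)) (sym (lookup-∸stepE-zero A t* y)))
      ... | inj₂ mb with memB-singleton c b mb
      ... | refl = trans (lookup-∸stepE-∉ A t* y c bnA) (sym y'0≡)
      q2 : RChain (lookup (y ∸v stepE A t*) zero) B (y ∸v stepE A t*)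
      q2 = subst (λ z → RChain z B (y ∸v stepE A t*)) (sym y'0≡)
             (RChain-cong yb B y (y ∸v stepE A t*) (λ c m → lookup-∸stepE-∉ A t* y c (BnA c m)) ch)
      un : ∀ t → t < K → stepE A t ≤v y → ChainSupport A' B (y ∸v stepE A t) → t ≡ t*
      un t _ le (q , _) = r*-injective (ℕP.+-cancelˡ-≡ yb (r * t) (r * t*) (trans (sym e1) eq*))
        where
        e1 : y0 ≡ yb + r * t
        e1 = ∸≡⇒≡+ (trans (sym (lookup-∸stepE-zero A t y)) (trans (sym (q b bA')) (lookup-∸stepE-∉ A t y b bnA)))
            (stepE-≤v⁻-zero A t y le)
    witness-of : ∀ t → t < K → stepE A t ≤v y → ChainSupport A' B (y ∸v stepE A t) → ChainSupport A (b ∷ B) y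
    witness-of t _ le (q , ch) = hA , (t , e1) , ch''
      where
      e1 : y0 ≡ yb + r * t
      e1 = ∸≡⇒≡+ (trans (sym (lookup-∸stepE-zero A t y)) (trans (sym (q b bA')) (lookup-∸stepE-∉ A t y b bnA)))
          (stepE-≤v⁻-zero A t y le)
      hA : ∀ c → memB c A ≡ true → lookup y (suc c) ≡ y0
      hA c m = ℕP.∸-cancelʳ-≡ (stepE-≤v⁻-∈ A t y c m le) (stepE-≤v⁻-zero A t y le)
        (trans (sym (lookup-∸stepE-∈ A t y c m)) (trans
            (q c (trans (memB-++ c A [ b ]) (subst (λ z → z ∨ memB c [ b ] ≡ true) (sym m) refl)))
                (lookup-∸stepE-zero A t y)))
      y'0≡ : lookup (y ∸v stepE A t) zero ≡ yb
      y'0≡ = trans (sym (q b bA')) (lookup-∸stepE-∉ A t y b bnA)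
      ch' : RChain (lookup (y ∸v stepE A t) zero) B y
      ch' = RChain-cong (lookup (y ∸v stepE A t) zero) B (y ∸v stepE A t) y
          (λ c m → sym (lookup-∸stepE-∉ A t y c (BnA c m))) ch
      ch'' : RChain yb B y
      ch'' = subst (λ z → RChain z B y) y'0≡ ch'

  chainSeries-Iverson : ∀ A B → Complementary A B → ∀ y → Iverson (ChainSupport A B y) (chainSeries A B y)
  chainSeries-Iverson A [] comp = chainSeries-Iverson-[] A comp
  chainSeries-Iverson A (b ∷ B) comp = chainSeries-Iverson-∷ A b B comp
      (chainSeries-Iverson (A ++ [ b ]) B (complementary-step A b B comp))

memB-lookup : ∀ {n k} (v : Vec (Fin n) k) i → memB (lookup v i) (toList v) ≡ true
memB-lookup (x ∷ v) zero = memB-here x (toList v)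
memB-lookup (x ∷ v) (suc i) = memB-there (lookup v i) x (toList v) (memB-lookup v i)

memB⇒lookup : ∀ {n k} (v : Vec (Fin n) k) c → memB c (toList v) ≡ true → ∃ λ i → lookup v i ≡ c
memB⇒lookup [] c ()
memB⇒lookup (x ∷ v) c h with memB-∷-true c x (toList v) h
... | inj₁ e = zero , sym e
... | inj₂ h' with memB⇒lookup v c h'
... | i , e = suc i , e

lookup-injective : ∀ {n k} (v : Vec (Fin n) k) → distinctB (toList v) ≡ true → ∀ i j → lookup v i ≡ lookup v j → i ≡ j
lookup-injective (x ∷ v) d zero zero e = refl
lookup-injective (x ∷ v) d zero (suc j) e = ⊥-elim (true≢false
    (trans (sym (memB-lookup v j)) (subst (λ z → memB z (toList v) ≡ false) e (distinctB-head x (toList v) d))))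
lookup-injective (x ∷ v) d (suc i) zero e = ⊥-elim (true≢false
    (trans (sym (memB-lookup v i)) (subst (λ z → memB z (toList v) ≡ false) (sym e) (distinctB-head x (toList v) d))))
lookup-injective (x ∷ v) d (suc i) (suc j) e = cong suc (lookup-injective v (distinctB-tail x (toList v) d) i j e)

distinctB⇒complete : ∀ {n} (π : Vec (Fin n) n) → distinctB (toList π) ≡ true → ∀ c → memB c (toList π) ≡ true
distinctB⇒complete {zero} π d ()
distinctB⇒complete {suc n} π d c with memB c (toList π) in eq
... | true = refl
... | false = ⊥-elim (contra (FinP.pigeonhole (ℕP.n<1+n n) f))
  where
  ne : ∀ i → c ≢ lookup π i
  ne i e = true≢false (trans (sym (memB-lookup π i)) (subst (λ z → memB z (toList π) ≡ false) e eq))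
  f : Fin (suc n) → Fin n
  f i = punchOut (ne i)
  contra : ¬ (∃ λ i → ∃ λ j → i Fin.< j × f i ≡ f j)
  contra (i , j , i<j , e) = FinP.<-irrefl (lookup-injective π d i j (FinP.punchOut-injective (ne i) (ne j) e)) i<j

applyUpTo-cong : ∀ {A : Set} (f g : ℕ → A) N → (∀ i → f i ≡ g i) → applyUpTo f N ≡ applyUpTo g N
applyUpTo-cong f g zero eq = refl
applyUpTo-cong f g (suc N) eq = cong₂ _∷_ (eq 0) (applyUpTo-cong (f ∘ suc) (g ∘ suc) N (eq ∘ suc))

take-length-++ : ∀ {A : Set} (X Y : List A) → take (length X) (X ++ Y) ≡ X
take-length-++ [] Y = refl
take-length-++ (x ∷ X) Y = cong (x ∷_) (take-length-++ X Y)

toList-injective : ∀ {A : Set} {k} (u v : Vec A k) → toList u ≡ toList v → u ≡ v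
toList-injective [] [] _ = refl
toList-injective (a ∷ u) (b ∷ v) e = cong₂ _∷_ (proj₁ (LP.∷-injective e)) (toList-injective u v (proj₂ (LP.∷-injective e)))

toList-tabulate : ∀ {n} {A : Set} (f : Fin n → A) → toList (Vec.tabulate f) ≡ List.tabulate f
toList-tabulate {zero} f = refl
toList-tabulate {suc n} f = cong (f zero ∷_) (toList-tabulate (f ∘ suc))

distinctB-allFinVec : ∀ n → distinctB (toList (Vec.allFin n)) ≡ true
distinctB-allFinVec n = trans (cong distinctB (toList-tabulate {n} id)) (distinctB-allFin n)

-- The summands of the right-hand side

module SummandFactors (n' r' : ℕ) where
  n = suc n'
  open Chains n r'

  chainExps-prefixes : ∀ A B → chainExps A B ≡ map (λ j → rPrefixE (take j (A ++ B)))
      (applyUpTo (λ i → length A + i) (suc (length B)))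
  chainExps-prefixes A [] = cong (λ z → rPrefixE z ∷ [])
      (sym (trans (cong (λ k → take k (A ++ [])) (ℕP.+-identityʳ (length A)))
                   (take-length-++ A [])))
  chainExps-prefixes A (b ∷ B) = cong₂ _∷_ (cong rPrefixE
      (sym (trans (cong (λ k → take k (A ++ b ∷ B)) (ℕP.+-identityʳ (length A))) (take-length-++ A (b ∷ B)))))
    (trans (chainExps-prefixes (A ++ [ b ]) B)
      (trans (cong (λ Z → map (λ j → rPrefixE (take j Z)) (applyUpTo (λ i → length (A ++ [ b ]) + i) (suc (length B))))
          (LP.++-assoc A [ b ] B))
        (cong (map (λ j → rPrefixE (take j (A ++ b ∷ B))))
            (applyUpTo-cong (λ i → length (A ++ [ b ]) + i) (λ i → length A + suc i) (suc (length B))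
          (λ i → trans (cong (_+ i) (LP.length-++ A {[ b ]})) (trans (ℕP.+-assoc (length A) 1 i) refl))))))

  rhsChainExps : (π : Vec (Fin n) n) → List (Exp (suc n))
  rhsChainExps π = map (λ j → scaleE r (prefE π j)) (List.map ℕ.suc (upTo n))

  rhsChainExps-chainExps : ∀ (p1 : Fin n) (πr : Vec (Fin n) n') → rhsChainExps (p1 ∷ πr) ≡ chainExps [ p1 ] (toList πr)
  rhsChainExps-chainExps p1 πr = trans (cong (map (λ j → rPrefixE (take j (p1 ∷ toList πr))))
      (LP.map-applyUpTo {A = ℕ} {B = ℕ} id ℕ.suc n))
    (sym (trans (chainExps-prefixes [ p1 ] (toList πr))
        (cong (λ k → map (λ j → rPrefixE (take j (p1 ∷ toList πr))) (applyUpTo suc (suc k))) (VP.length-toList πr))))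

  z0E : Exp (suc n)
  z0E = 1 ∷ zeroE

  rhsTerm-chainSeries : ∀ (p1 : Fin n) (πr : Vec (Fin n) n') w →
    rhsTerm r n (p1 ∷ πr) w ≡ (mono (numeratorE r (p1 ∷ πr) w) *s (geomInv z0E *s chainSeries [ p1 ] (toList πr)))
  rhsTerm-chainSeries p1 πr w = cong (λ (L : List (Series (suc n))) → mono (numeratorE r (p1 ∷ πr) w) *s
      (geomInv z0E *s prodS L))
     (trans ((LP.map-∘ {g = geomInv} {f = λ j → scaleE r (prefE (p1 ∷ πr) j)} (List.map ℕ.suc (upTo n))))
         (cong (map geomInv) (rhsChainExps-chainExps p1 πr)))

  TopSupport : Fin n → List (Fin n) → Exp (suc n) → Set
  TopSupport p1 rest y = (lookup y (suc p1) ≤ lookup y zero) × RChain (lookup y (suc p1)) rest y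

  lookup-scaleE-z0E-zero : ∀ t → lookup (scaleE t z0E) zero ≡ t
  lookup-scaleE-z0E-zero t = ℕP.*-identityʳ t
  lookup-scaleE-z0E-suc : ∀ t c → lookup (scaleE t z0E) (suc c) ≡ 0
  lookup-scaleE-z0E-suc t c = trans (lookup-scaleE t z0E (suc c)) (trans (cong (t *_) (lookup-zeroE c)) (ℕP.*-zeroʳ t))

  complementary-head : ∀ (p1 : Fin n) (πr : Vec (Fin n) n') → distinctB (toList (p1 ∷ πr)) ≡ true → Complementary [ p1 ]
      (toList πr)
  complementary-head p1 πr d = (λ c m → case c m) , distinctB-tail p1 (toList πr) d , cov
    where
    case : ∀ c → memB c [ p1 ] ≡ true → memB c (toList πr) ≡ false
    case c m with memB-singleton c p1 m
    ... | refl = distinctB-head p1 (toList πr) d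
    cov : ∀ c → memB c [ p1 ] ≡ false → memB c (toList πr) ≡ true
    cov c m = trans (sym (memB-≢ c p1 (toList πr) (memB-false⇒≢ c p1 [] m))) (distinctB⇒complete (p1 ∷ πr) d c)

  geomInv*chainSeries-Iverson : ∀ (p1 : Fin n) (πr : Vec (Fin n) n') → distinctB (toList (p1 ∷ πr)) ≡ true → ∀ y →
    Iverson (TopSupport p1 (toList πr) y) ((geomInv z0E *s chainSeries [ p1 ] (toList πr)) y)
  geomInv*chainSeries-Iverson p1 πr d y = subst (Iverson (TopSupport p1 rest y)) (sym val)
      (Iverson-sumUp-shift (chainSeries [ p1 ] rest) (ChainSupport [ p1 ] rest)
          (chainSeries-Iverson [ p1 ] rest (complementary-head p1 πr d)) (TopSupport p1 rest y) y K
              (λ t → scaleE t z0E) unique-of witness-of)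
    where
    rest = toList πr
    K = suc (lookup y zero)
    val : (geomInv z0E *s chainSeries [ p1 ] rest) y ≡ sumUp K (λ t → (mono (scaleE t z0E) *s chainSeries [ p1 ] rest) y)
    val = geomInv*s-sumUp z0E y (chainSeries [ p1 ] rest) (s≤s z≤n)
    y0 = lookup y zero
    y1 = lookup y (suc p1)
    lookup-shift-zero : ∀ t → lookup (y ∸v scaleE t z0E) zero ≡ y0 ∸ t
    lookup-shift-zero t = trans (lookup-∸v y (scaleE t z0E) zero) (cong (y0 ∸_) (lookup-scaleE-z0E-zero t))
    lookup-shift-suc : ∀ t c → lookup (y ∸v scaleE t z0E) (suc c) ≡ lookup y (suc c)
    lookup-shift-suc t c = trans (lookup-∸v y (scaleE t z0E) (suc c)) (cong (lookup y (suc c) ∸_) (lookup-scaleE-z0E-suc t c))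
    powZ0-≤v : ∀ t → t ≤ y0 → scaleE t z0E ≤v y
    powZ0-≤v t le = ≤v-from-lookup (scaleE t z0E) y (λ { zero → subst (_≤ y0) (sym (lookup-scaleE-z0E-zero t)) le ;
        (suc c) → subst (_≤ lookup y (suc c)) (sym (lookup-scaleE-z0E-suc t c)) z≤n })
    powZ0-≤v⁻ : ∀ t → scaleE t z0E ≤v y → t ≤ y0
    powZ0-≤v⁻ t le = subst (_≤ y0) (lookup-scaleE-z0E-zero t) (Pw.lookup le zero)
    unique-of : TopSupport p1 rest y → UniqueShift K (λ t → scaleE t z0E) y (ChainSupport [ p1 ] rest)
    unique-of (le1 , ch) = record { t* = y0 ∸ y1 ; t*<K = s≤s (ℕP.m∸n≤m y0 y1) ; le* = powZ0-≤v (y0 ∸ y1) (ℕP.m∸n≤m y0 y1)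
       ; q* = q1 , q2 ; uniq = un }
      where
      e0 : lookup (y ∸v scaleE (y0 ∸ y1) z0E) zero ≡ y1
      e0 = trans (lookup-shift-zero (y0 ∸ y1)) (ℕP.m∸[m∸n]≡n le1)
      q1 : ∀ c → memB c [ p1 ] ≡ true → _
      q1 c m with memB-singleton c p1 m
      ... | refl = trans (lookup-shift-suc (y0 ∸ y1) c) (sym e0)
      q2 = subst (λ z → RChain z rest (y ∸v scaleE (y0 ∸ y1) z0E)) (sym e0)
             (RChain-cong y1 rest y _ (λ c _ → lookup-shift-suc (y0 ∸ y1) c) ch)
      un : ∀ t → t < K → scaleE t z0E ≤v y → ChainSupport [ p1 ] rest (y ∸v scaleE t z0E) → t ≡ y0 ∸ y1
      un t _ le (q , _) = sym (trans (cong (y0 ∸_) (trans (sym (lookup-shift-suc t p1)) (trans (q p1 (memB-here p1 [])) (lookup-shift-zero t))))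
                            (ℕP.m∸[m∸n]≡n (powZ0-≤v⁻ t le)))
    witness-of : ∀ t → t < K → scaleE t z0E ≤v y → ChainSupport [ p1 ] rest (y ∸v scaleE t z0E) → TopSupport p1 rest y
    witness-of t _ le (q , ch) = subst (_≤ y0) (sym e1) (ℕP.m∸n≤m y0 t) , subst (λ z → RChain z rest y) (sym e1)
         (RChain-cong _ rest (y ∸v scaleE t z0E) y (λ c _ → sym (lookup-shift-suc t c)) ch')
      where
      e1 : y1 ≡ y0 ∸ t
      e1 = trans (sym (lookup-shift-suc t p1)) (trans (q p1 (memB-here p1 [])) (lookup-shift-zero t))
      ch' : RChain (y0 ∸ t) rest (y ∸v scaleE t z0E)
      ch' = subst (λ z → RChain z rest (y ∸v scaleE t z0E)) (lookup-shift-zero t) ch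

  rhsTerm-Iverson-support : ∀ (p1 : Fin n) (πr : Vec (Fin n) n') w → distinctB (toList (p1 ∷ πr)) ≡ true → ∀ e →
    Iverson ((numeratorE r (p1 ∷ πr) w ≤v e) × TopSupport p1 (toList πr) (e ∸v numeratorE r (p1 ∷ πr) w))
        (rhsTerm r n (p1 ∷ πr) w e)
  rhsTerm-Iverson-support p1 πr w d e = subst (Iverson _) (sym (cong (λ f → f e) (rhsTerm-chainSeries p1 πr w)))
    (Iverson-mono*s _ (TopSupport p1 (toList πr)) (geomInv*chainSeries-Iverson p1 πr d) (numeratorE r (p1 ∷ πr) w) e)

-- The exponents of the numerator

sumℕ : ∀ {A : Set} → (A → ℕ) → List A → ℕ
sumℕ f = foldr (λ x acc → f x + acc) 0

sumℕ-cong-All : ∀ {A : Set} {f g : A → ℕ} (l : List A) → All (λ x → f x ≡ g x) l → sumℕ f l ≡ sumℕ g l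
sumℕ-cong-All [] [] = refl
sumℕ-cong-All (x ∷ l) (e ∷ es) = cong₂ _+_ e (sumℕ-cong-All l es)

sumℕ-cong : ∀ {A : Set} {f g : A → ℕ} (l : List A) → (∀ x → f x ≡ g x) → sumℕ f l ≡ sumℕ g l
sumℕ-cong [] h = refl
sumℕ-cong (x ∷ l) h = cong₂ _+_ (h x) (sumℕ-cong l h)

sumℕ-+ : ∀ {A : Set} (f g : A → ℕ) l → sumℕ (λ x → f x + g x) l ≡ sumℕ f l + sumℕ g l
sumℕ-+ f g [] = refl
sumℕ-+ f g (x ∷ l) rewrite sumℕ-+ f g l = +-interchange (f x) (g x) (sumℕ f l) (sumℕ g l)

sumℕ-zero : ∀ {A : Set} (f : A → ℕ) l → All (λ x → f x ≡ 0) l → sumℕ f l ≡ 0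
sumℕ-zero f [] [] = refl
sumℕ-zero f (x ∷ l) (e ∷ es) rewrite e = sumℕ-zero f l es

ind : Bool → ℕ
ind b = if b then 1 else 0

lookup-foldr-addE : ∀ {m} {A : Set} (f : A → Exp m) l i → lookup (foldr (λ j acc → addE (f j) acc) zeroE l) i ≡ sumℕ
    (λ j → lookup (f j) i) l
lookup-foldr-addE f [] i = lookup-zeroE i
lookup-foldr-addE f (j ∷ l) i = trans (lookup-addE (f j) _ i) (cong (lookup (f j) i +_) (lookup-foldr-addE f l i))

lookup-foldr-addE-scaleE : ∀ {m} (f : ℕ → Exp m) (l : List (ℕ × ℕ)) i →
  lookup (foldr (λ p acc → addE (scaleE (proj₂ p) (f (proj₁ p))) acc) zeroE l) i ≡ sumℕ
      (λ p → proj₂ p * lookup (f (proj₁ p)) i) l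
lookup-foldr-addE-scaleE f [] i = lookup-zeroE i
lookup-foldr-addE-scaleE f (p ∷ l) i = trans (lookup-addE (scaleE (proj₂ p) (f (proj₁ p))) _ i)
    (cong₂ _+_ (lookup-scaleE (proj₂ p) (f (proj₁ p)) i) (lookup-foldr-addE-scaleE f l i))

memB-take-position : ∀ {n} (pre : List (Fin n)) c suf j → distinctB (pre ++ c ∷ suf) ≡ true →
  memB c (take j (pre ++ c ∷ suf)) ≡ (length pre <ᵇ j)
memB-take-position [] c suf zero d = refl
memB-take-position [] c suf (suc j) d = memB-here c (take j suf)
memB-take-position (a ∷ pre) c suf zero d = refl
memB-take-position (a ∷ pre) c suf (suc j) d =
  trans (memB-≢ c a (take j (pre ++ c ∷ suf)) ne) (memB-take-position pre c suf j (distinctB-tail a (pre ++ c ∷ suf) d))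
  where
  inTail : memB c (pre ++ c ∷ suf) ≡ true
  inTail = trans (memB-++ c pre (c ∷ suf)) (trans (cong (memB c pre ∨_) (memB-here c suf)) (BP.∨-zeroʳ (memB c pre)))
  ne : c ≢ a
  ne refl = true≢false (trans (sym inTail) (distinctB-head a (pre ++ c ∷ suf) d))

desFrom-bounds : ∀ {n} s (l : List (Fin n)) → All (λ j → s ≤ j × suc (suc j) ≤ s + length l) (desFrom s l)
desFrom-bounds s [] = []
desFrom-bounds s (x ∷ []) = []
desFrom-bounds s (x ∷ y ∷ t) = AllP.++⁺ first (All.map
    (λ { {j} (a , b) → ℕP.<⇒≤ a , subst (suc (suc j) ≤_) (sym (ℕP.+-suc s (length (y ∷ t)))) b })
        (desFrom-bounds (suc s) (y ∷ t)))
  where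
  first : All (λ j → s ≤ j × suc (suc j) ≤ s + length (x ∷ y ∷ t)) (if toℕ y <ᵇ toℕ x then [ s ] else [])
  first with toℕ y <ᵇ toℕ x
  ... | true = (ℕP.≤-refl , subst (suc (suc s) ≤_) (sym (trans (ℕP.+-suc s _) (cong suc (ℕP.+-suc s _))))
      (s≤s (s≤s (ℕP.m≤m+n s _)))) ∷ []
  ... | false = []

ind-<ᵇ-split : ∀ m j → ind (m <ᵇ j) ≡ ind (j ≡ᵇ suc m) + ind (suc m <ᵇ j)
ind-<ᵇ-split zero zero = refl
ind-<ᵇ-split zero (suc zero) = refl
ind-<ᵇ-split zero (suc (suc j)) = refl
ind-<ᵇ-split (suc m) zero = refl
ind-<ᵇ-split (suc m) (suc j) = ind-<ᵇ-split m j

≡ᵇ-refl : ∀ k → (k ≡ᵇ k) ≡ true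
≡ᵇ-refl zero = refl
≡ᵇ-refl (suc k) = ≡ᵇ-refl k

≡ᵇ-false : ∀ j k → j ≢ k → (j ≡ᵇ k) ≡ false
≡ᵇ-false zero zero ne = ⊥-elim (ne refl)
≡ᵇ-false zero (suc k) ne = refl
≡ᵇ-false (suc j) zero ne = refl
≡ᵇ-false (suc j) (suc k) ne = ≡ᵇ-false j k (λ e → ne (cong suc e))

<ᵇ-false : ∀ m j → j ≤ m → (m <ᵇ j) ≡ false
<ᵇ-false m zero _ = refl
<ᵇ-false (suc m) (suc j) (s≤s le) = <ᵇ-false m j le

<ᵇ-true : ∀ m j → m < j → (m <ᵇ j) ≡ true
<ᵇ-true zero (suc j) _ = refl
<ᵇ-true (suc m) (suc j) (s≤s le) = <ᵇ-true m j le

<ᵇ-false⇒≥ : ∀ a b → (a <ᵇ b) ≡ false → b ≤ a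
<ᵇ-false⇒≥ a b h with a ℕP.<? b
... | yes lt = ⊥-elim (true≢false (trans (sym (<ᵇ-true a b lt)) h))
... | no nlt = ℕP.≮⇒≥ nlt

≡ᵇ-true⇒≡ : ∀ a b → (a ≡ᵇ b) ≡ true → a ≡ b
≡ᵇ-true⇒≡ zero zero _ = refl
≡ᵇ-true⇒≡ (suc a) (suc b) h = cong suc (≡ᵇ-true⇒≡ a b h)

ind-≡ᵇ-toℕ : ∀ {n} (a b : Fin n) → ind (toℕ a ≡ᵇ toℕ b) ≡ (if does (a Fin.≟ b) then 1 else 0)
ind-≡ᵇ-toℕ a b with a Fin.≟ b
... | yes refl = cong ind (≡ᵇ-refl (toℕ a))
... | no ne = cong ind (≡ᵇ-false (toℕ a) (toℕ b) (λ e → ne (FinP.toℕ-injective e)))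

occ : ℕ → List ℕ → ℕ
occ k = sumℕ (λ j → ind (j ≡ᵇ k))

occ-desFrom-before : ∀ {n} k s (l : List (Fin n)) → k < s → occ k (desFrom s l) ≡ 0
occ-desFrom-before k s l lt = sumℕ-zero (λ j → ind (j ≡ᵇ k)) (desFrom s l)
    (All.map (λ { {j} (a , _) → cong ind (≡ᵇ-false j k (λ { refl → ℕP.<-irrefl refl (ℕP.<-≤-trans lt a) })) })
        (desFrom-bounds s l))

occ-desFrom-last : ∀ {n} (pre : List (Fin n)) p → occ (suc (length pre)) (desFrom 1 (pre ++ [ p ])) ≡ 0
occ-desFrom-last pre p = sumℕ-zero (λ j → ind (j ≡ᵇ suc (length pre))) (desFrom 1 (pre ++ [ p ]))
    (All.map (λ { {j} (_ , b) → cong ind (≡ᵇ-false j _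
        (λ { refl → ℕP.<-irrefl refl (ℕP.≤-trans b (ℕP.≤-reflexive
            (cong suc (trans (LP.length-++ pre) (ℕP.+-comm (length pre) 1))))) })) }) (desFrom-bounds 1 (pre ++ [ p ])))

occ-desFrom-step : ∀ {n} s k (a b : Fin n) l → s ≢ k → occ k (desFrom s (a ∷ b ∷ l)) ≡ occ k (desFrom (suc s) (b ∷ l))
occ-desFrom-step s k a b l ne with toℕ b <ᵇ toℕ a
... | true = cong (_+ occ k (desFrom (suc s) (b ∷ l))) (cong ind (≡ᵇ-false s k ne))
... | false = refl

occ-desFrom-position : ∀ {n} s (pre : List (Fin n)) p q t → occ (s + length pre) (desFrom s (pre ++ p ∷ q ∷ t)) ≡ ind
    (toℕ q <ᵇ toℕ p)
occ-desFrom-position s [] p q t rewrite ℕP.+-identityʳ s with toℕ q <ᵇ toℕ p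
... | true = cong₂ _+_ (cong ind (≡ᵇ-refl s)) (occ-desFrom-before s (suc s) (q ∷ t) (ℕP.n<1+n s))
... | false = occ-desFrom-before s (suc s) (q ∷ t) (ℕP.n<1+n s)
occ-desFrom-position s (a ∷ []) p q t = trans (occ-desFrom-step s (s + 1) a p (q ∷ t)
    (λ e → ℕP.<-irrefl e (subst (s <_) (sym (ℕP.+-comm s 1)) (ℕP.n<1+n s))))
   (trans (cong (λ k → occ k (desFrom (suc s) (p ∷ q ∷ t))) (trans (ℕP.+-comm s 1) (sym (ℕP.+-identityʳ (suc s)))))
       (occ-desFrom-position (suc s) [] p q t))
occ-desFrom-position s (a ∷ b ∷ pre) p q t = trans (occ-desFrom-step s (s + suc (suc (length pre))) a b (pre ++ p ∷ q ∷ t)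
      (λ e → ℕP.<-irrefl e (ℕP.m<m+n s (s≤s z≤n))))
   (trans (cong (λ k → occ k (desFrom (suc s) (b ∷ pre ++ p ∷ q ∷ t))) (ℕP.+-suc s (suc (length pre))))
       (occ-desFrom-position (suc s) (b ∷ pre) p q t))

module Numerator (n r : ℕ) (π : Vec (Fin n) n) (w : Colored n) where
  L = toList π
  Ds = Des π
  NL = NNegInv r w
  N = numeratorE r π w

  fD : ℕ → ℕ → ℕ
  fD m j = ind (m <ᵇ j)
  fN : ℕ → ℕ × ℕ → ℕ
  fN m p = proj₂ p * ind (m <ᵇ proj₁ p)
  gD : ℕ → ℕ → ℕ
  gD m j = ind (j ≡ᵇ suc m)
  gN : ℕ → ℕ × ℕ → ℕ
  gN m p = proj₂ p * ind (proj₁ p ≡ᵇ suc m)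

  -- Since z_{π(m+1)} occurs in the prefix products with index j > m, tailExp m is its exponent in the numerator.
  tailExp : ℕ → ℕ
  tailExp m = sumℕ (fD m) Ds + sumℕ (fN m) NL

  nnegMult : ℕ → ℕ
  nnegMult m = sumℕ (gN m) NL

  stepExp : ℕ → ℕ
  stepExp m = occ (suc m) Ds + nnegMult m

  lD : Fin (suc n) → ℕ → ℕ
  lD i j = lookup (prefE π j) i
  lN : Fin (suc n) → ℕ × ℕ → ℕ
  lN i p = proj₂ p * lookup (prefE π (proj₁ p)) i

  lookup-numerator : ∀ i → lookup N i ≡ sumℕ (lD i) Ds + sumℕ (lN i) NL
  lookup-numerator i =
    trans (lookup-addE (foldr (λ j acc → addE (prefE π j) acc) zeroE Ds)
                       (foldr (λ p acc → addE (scaleE (proj₂ p) (prefE π (proj₁ p))) acc) zeroE NL) i)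
          (cong₂ _+_ (lookup-foldr-addE (prefE π) Ds i) (lookup-foldr-addE-scaleE (prefE π) NL i))

  lookup-prefE-suc : ∀ j c → lookup (prefE π j) (suc c) ≡ ind (memB c (take j L))
  lookup-prefE-suc j c = VP.lookup∘tabulate (λ i → if memB i (take j L) then 1 else 0) c

  lookup-numerator-suc : distinctB L ≡ true → ∀ pre c suf → L ≡ pre ++ c ∷ suf → lookup N (suc c) ≡ tailExp (length pre)
  lookup-numerator-suc d pre c suf eq = trans (lookup-numerator (suc c)) (cong₂ _+_
    (sumℕ-cong {f = lD (suc c)} {g = fD (length pre)} Ds (λ j → trans (lookup-prefE-suc j c) (cong ind (pl j))))
    (sumℕ-cong {f = lN (suc c)} {g = fN (length pre)} NL
      (λ p → cong (proj₂ p *_) (trans (lookup-prefE-suc (proj₁ p) c) (cong ind (pl (proj₁ p)))))))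
    where
    pl : ∀ j → memB c (take j L) ≡ (length pre <ᵇ j)
    pl j = trans (cong (λ z → memB c (take j z)) eq) (memB-take-position pre c suf j (subst (λ z → distinctB z ≡ true) eq d))

  nnf : Fin n → ℕ → ℕ × ℕ
  nnf v ci = (suc (toℕ v) , negCol r ci)

  nnegPositions-bounds : ∀ {k} (ρ : Vec (Fin n) k) (c : Vec ℕ k) → All (λ p → 1 ≤ proj₁ p × proj₁ p ≤ n)
      (toList (zipWith nnf ρ c))
  nnegPositions-bounds Vec.[] Vec.[] = []
  nnegPositions-bounds (v Vec.∷ ρ) (ci Vec.∷ c) = (s≤s z≤n , FinP.toℕ<n v) ∷ nnegPositions-bounds ρ c

  lookup-numerator-zero : lookup N zero ≡ tailExp 0
  lookup-numerator-zero = trans (lookup-numerator zero) (cong₂ _+_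
         (sumℕ-cong-All {f = lD zero} {g = fD 0} Ds
             (All.map {P = λ j → 1 ≤ j × suc (suc j) ≤ 1 + length L} {Q = λ j → lD zero j ≡ fD 0 j}
                 (λ { {j} (a , _) → sym (cong ind (<ᵇ-true 0 j a)) }) (desFrom-bounds 1 L)))
         (sumℕ-cong-All {f = lN zero} {g = fN 0} NL
             (All.map {P = λ p → 1 ≤ proj₁ p × proj₁ p ≤ n} {Q = λ p → lN zero p ≡ fN 0 p}
                 (λ { {p} (a , _) → cong (proj₂ p *_) (sym (cong ind (<ᵇ-true 0 (proj₁ p) a))) })
                     (nnegPositions-bounds (proj₁ w) (proj₂ w)))))

  tailExp-suc : ∀ m → tailExp m ≡ stepExp m + tailExp (suc m)
  tailExp-suc m = begin
      sumℕ (fD m) Ds + sumℕ (fN m) NL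
    ≡⟨ cong₂ _+_ (sumℕ-cong Ds (ind-<ᵇ-split m))
                 (sumℕ-cong NL (λ p → trans (cong (proj₂ p *_) (ind-<ᵇ-split m (proj₁ p))) (ℕP.*-distribˡ-+ (proj₂ p) _ _))) ⟩
      sumℕ (λ j → gD m j + fD (suc m) j) Ds + sumℕ (λ p → gN m p + fN (suc m) p) NL
    ≡⟨ cong₂ _+_ (sumℕ-+ (gD m) (fD (suc m)) Ds) (sumℕ-+ (gN m) (fN (suc m)) NL) ⟩
      (sumℕ (gD m) Ds + sumℕ (fD (suc m)) Ds) + (sumℕ (gN m) NL + sumℕ (fN (suc m)) NL)
    ≡⟨ +-interchange (sumℕ (gD m) Ds) (sumℕ (fD (suc m)) Ds) (sumℕ (gN m) NL) (sumℕ (fN (suc m)) NL) ⟩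
      stepExp m + tailExp (suc m) ∎
    where open ≡-Reasoning

  tailExp-n : tailExp n ≡ 0
  tailExp-n = cong₂ _+_
    (sumℕ-zero (fD n) Ds (All.map {P = λ j → 1 ≤ j × suc (suc j) ≤ 1 + length L} {Q = λ j → fD n j ≡ 0}
        (λ { {j} (_ , b) → cong ind (<ᵇ-false n j (ℕP.<⇒≤
            (ℕP.≤-pred (ℕP.≤-trans b (ℕP.≤-reflexive (cong suc (VP.length-toList π))))))) }) (desFrom-bounds 1 L)))
    (sumℕ-zero (fN n) NL (All.map {P = λ p → 1 ≤ proj₁ p × proj₁ p ≤ n} {Q = λ p → fN n p ≡ 0}
        (λ { {p} (_ , b) → trans (cong (proj₂ p *_) (cong ind (<ᵇ-false n (proj₁ p) b))) (ℕP.*-zeroʳ (proj₂ p)) })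
            (nnegPositions-bounds (proj₁ w) (proj₂ w))))

-- The support of a summand

length-snoc : ∀ {A : Set} (pre : List A) p → length (pre ++ [ p ]) ≡ suc (length pre)
length-snoc pre p = trans (LP.length-++ pre {[ p ]}) (ℕP.+-comm (length pre) 1)

split-next : ∀ {A : Set} (pre : List A) {L p rest} → L ≡ pre ++ p ∷ rest → L ≡ (pre ++ [ p ]) ++ rest
split-next pre {p = p} {rest} eq = trans eq (sym (LP.∷ʳ-++ pre p rest))

∸-shift⁻¹ : ∀ xp xq c gq s → gq ≤ xq → c + gq ≤ xp → (xp ∸ (c + gq) ≡ (xq ∸ gq) + s) → xp ≡ xq + c + s
∸-shift⁻¹ xp xq c gq s l1 l2 eq = begin
    xp ≡⟨ sym (ℕP.m∸n+n≡m l2) ⟩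
    xp ∸ (c + gq) + (c + gq) ≡⟨ cong (_+ (c + gq)) eq ⟩
    (xq ∸ gq) + s + (c + gq) ≡⟨ sol (xq ∸ gq) s c gq ⟩
    ((xq ∸ gq) + gq) + c + s ≡⟨ cong (λ z → z + c + s) (ℕP.m∸n+n≡m l1) ⟩
    xq + c + s ∎
  where
  open ≡-Reasoning
  sol : ∀ a b c d → a + b + (c + d) ≡ a + d + c + b
  sol = solve 4 (λ a b c d → a :+ b :+ (c :+ d) := a :+ d :+ c :+ b) refl

∸-shift : ∀ xp xq c gq s → gq ≤ xq → xp ≡ xq + c + s → xp ∸ (c + gq) ≡ (xq ∸ gq) + s
∸-shift xp xq c gq s l1 refl = begin
    xq + c + s ∸ (c + gq) ≡⟨ cong (λ z → z + c + s ∸ (c + gq)) (sym (ℕP.m∸n+n≡m l1)) ⟩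
    (xq ∸ gq) + gq + c + s ∸ (c + gq) ≡⟨ cong (_∸ (c + gq)) (sol (xq ∸ gq) gq c s) ⟩
    (xq ∸ gq) + s + (c + gq) ∸ (c + gq) ≡⟨ ℕP.m+n∸n≡m _ (c + gq) ⟩
    (xq ∸ gq) + s ∎
  where
  open ≡-Reasoning
  sol : ∀ a b c d → a + b + c + d ≡ a + d + (c + b)
  sol = solve 4 (λ a b c d → a :+ b :+ c :+ d := a :+ d :+ (c :+ b)) refl

module SummandSupport (n' r' : ℕ) (p1 : Fin (suc n')) (πr : Vec (Fin (suc n')) n') (w : Colored (suc n'))
            (e : Exp (suc (suc n'))) where
  n = suc n'
  r = suc r'
  π : Vec (Fin n) n
  π = p1 ∷ πr
  open Numerator n r π w
  open Chains n r' using (RChain)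
  open SummandFactors n' r' using (TopSupport)

  x : Fin n → ℕ
  x c = lookup e (suc c)
  e0 = lookup e zero
  numExp : Fin n → ℕ
  numExp c = lookup N (suc c)
  y = e ∸v N

  -- m is the 0-based position in π of the head of the list, and the last step goes down to 0.
  Staircase : ℕ → List (Fin n) → Set
  Staircase m [] = ⊤
  Staircase m (p ∷ []) = ∃ λ s → x p ≡ stepExp m + r * s
  Staircase m (p ∷ q ∷ t) = (∃ λ s → x p ≡ x q + stepExp m + r * s) × Staircase (suc m) (q ∷ t)

  lenL : length L ≡ n
  lenL = VP.length-toList π

  lookup-y : ∀ c → lookup y (suc c) ≡ x c ∸ numExp c
  lookup-y c = lookup-∸v e N (suc c)

  last-position : ∀ pre p → L ≡ pre ++ p ∷ [] → length pre ≡ n'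
  last-position pre p eq = ℕP.suc-injective (trans (trans (ℕP.+-comm 1 (length pre)) (sym (LP.length-++ pre {[ p ]})))
      (trans (cong length (sym eq)) lenL))

  NumeratorFits : List (Fin n) → Set
  NumeratorFits S = ∀ c → memB c S ≡ true → numExp c ≤ x c

  NumeratorFits-tail : ∀ p S → NumeratorFits (p ∷ S) → NumeratorFits S
  NumeratorFits-tail p S b c m = b c (memB-there c p S m)

  Good : Set
  Good = (x p1 ≤ e0) × Staircase 0 L

  module _ (d : distinctB (toList π) ≡ true) where

    numExp-at : ∀ pre c suf → L ≡ pre ++ c ∷ suf → numExp c ≡ tailExp (length pre)
    numExp-at pre c suf eq = lookup-numerator-suc d pre c suf eq

    numExp-step : ∀ pre p q t → L ≡ pre ++ p ∷ q ∷ t → numExp p ≡ stepExp (length pre) + numExp q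
    numExp-step pre p q t eq = trans (numExp-at pre p (q ∷ t) eq) (trans (tailExp-suc (length pre))
        (cong (stepExp (length pre) +_) (sym (trans (numExp-at (pre ++ [ p ]) q t (split-next pre eq))
            (cong tailExp (length-snoc pre p))))))

    numExp-last : ∀ pre p → L ≡ pre ++ p ∷ [] → numExp p ≡ stepExp (length pre)
    numExp-last pre p eq = trans (numExp-at pre p [] eq) (trans (tailExp-suc (length pre))
       (trans (cong (λ z → stepExp (length pre) + tailExp z) (cong suc (last-position pre p eq)))
           (trans (cong (stepExp (length pre) +_) tailExp-n) (ℕP.+-identityʳ _))))

    chain⇒staircase : ∀ pre p rest → L ≡ pre ++ p ∷ rest → NumeratorFits (p ∷ rest) → RChain
        (x p ∸ numExp p) rest y → Staircase (length pre) (p ∷ rest)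
    chain⇒staircase pre p [] eq b (s , h) = s , trans (sym (ℕP.m∸n+n≡m (b p (memB-here p []))))
        (trans (cong₂ _+_ h (numExp-last pre p eq)) (ℕP.+-comm (r * s) _))
    chain⇒staircase pre p (q ∷ t) eq b ((s , h) , ch) =
        (s , ∸-shift⁻¹ (x p) (x q) (stepExp (length pre)) (numExp q) (r * s) (b q (memB-there q p (q ∷ t) (memB-here q t)))
         (subst (_≤ x p) (numExp-step pre p q t eq) (b p (memB-here p (q ∷ t))))
             (trans (cong (x p ∸_) (sym (numExp-step pre p q t eq))) (trans h (cong (_+ r * s) (lookup-y q)))))
       , subst (λ z → Staircase z (q ∷ t)) (length-snoc pre p)
           (chain⇒staircase (pre ++ [ p ]) q t (split-next pre eq) (NumeratorFits-tail p (q ∷ t) b)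
            (subst (λ z → RChain z t y) (lookup-y q) ch))

    staircase⇒chain : ∀ pre p rest → L ≡ pre ++ p ∷ rest → NumeratorFits (p ∷ rest) → Staircase (length pre)
        (p ∷ rest) → RChain (x p ∸ numExp p) rest y
    staircase⇒chain pre p [] eq b (s , h) = s , trans (cong₂ _∸_ h (numExp-last pre p eq))
        (ℕP.m+n∸m≡n (stepExp (length pre)) (r * s))
    staircase⇒chain pre p (q ∷ t) eq b ((s , h) , gc) =
        (s , trans (cong (x p ∸_) (numExp-step pre p q t eq))
            (trans (∸-shift (x p) (x q) (stepExp (length pre)) (numExp q) (r * s)
                (b q (memB-there q p (q ∷ t) (memB-here q t))) h) (cong (_+ r * s) (sym (lookup-y q)))))
      , subst (λ z → RChain z t y) (sym (lookup-y q))
          (staircase⇒chain (pre ++ [ p ]) q t (split-next pre eq) (NumeratorFits-tail p (q ∷ t) b)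
            (subst (λ z → Staircase z (q ∷ t)) (sym (length-snoc pre p)) gc))

    staircase⇒fits : ∀ pre p rest → L ≡ pre ++ p ∷ rest → Staircase (length pre) (p ∷ rest) → NumeratorFits (p ∷ rest)
    staircase⇒fits pre p [] eq (s , h) c m with memB-singleton c p m
    ... | refl = subst (_≤ x c) (sym (numExp-last pre c eq)) (subst (stepExp (length pre) ≤_) (sym h) (ℕP.m≤m+n _ _))
    staircase⇒fits pre p (q ∷ t) eq ((s , h) , gc) c m = case (memB-∷-true c p (q ∷ t) m)
      where
      IH : NumeratorFits (q ∷ t)
      IH = staircase⇒fits (pre ++ [ p ]) q t (split-next pre eq)
          (subst (λ z → Staircase z (q ∷ t)) (sym (length-snoc pre p)) gc)
      case : (c ≡ p) ⊎ (memB c (q ∷ t) ≡ true) → numExp c ≤ x c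
      case (inj₂ m') = IH c m'
      case (inj₁ refl) = subst (_≤ x c) (sym (numExp-step pre c q t eq))
        (subst (stepExp (length pre) + numExp q ≤_) (sym h)
          (ℕP.≤-trans (ℕP.≤-reflexive (ℕP.+-comm (stepExp (length pre)) (numExp q)))
            (ℕP.≤-trans (ℕP.+-monoˡ-≤ (stepExp (length pre)) (IH q (memB-here q t)))
                (ℕP.m≤m+n (x q + stepExp (length pre)) (r * s)))))

    lookup-numerator-zero-first : lookup N zero ≡ numExp p1
    lookup-numerator-zero-first = trans lookup-numerator-zero (sym (numExp-at [] p1 (toList πr) refl))

    support⇒good : (N ≤v e × TopSupport p1 (toList πr) y) → Good
    support⇒good (le , (t1 , ch)) = x≤ , chain⇒staircase [] p1 (toList πr) refl b
        (subst (λ z → RChain z (toList πr) y) (lookup-y p1) ch)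
      where
      b : NumeratorFits L
      b c _ = Pw.lookup le (suc c)
      k≤e0 : numExp p1 ≤ e0
      k≤e0 = subst (_≤ e0) lookup-numerator-zero-first (Pw.lookup le zero)
      x≤ : x p1 ≤ e0
      x≤ = subst₂ _≤_ (ℕP.m∸n+n≡m (b p1 (memB-here p1 (toList πr)))) (ℕP.m∸n+n≡m k≤e0)
             (ℕP.+-monoˡ-≤ (numExp p1) (subst₂ _≤_ (lookup-y p1)
                 (trans (lookup-∸v e N zero) (cong (e0 ∸_) lookup-numerator-zero-first)) t1))

    good⇒support : Good → (N ≤v e × TopSupport p1 (toList πr) y)
    good⇒support (x≤ , gc) = le , (t1 , subst (λ z → RChain z (toList πr) y) (sym (lookup-y p1))
        (staircase⇒chain [] p1 (toList πr) refl b gc))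
      where
      b : NumeratorFits L
      b = staircase⇒fits [] p1 (toList πr) refl gc
      le : N ≤v e
      le = ≤v-from-lookup N e (λ { zero → subst (_≤ e0) (sym lookup-numerator-zero-first)
          (ℕP.≤-trans (b p1 (memB-here p1 (toList πr))) x≤)
                        ; (suc c) → b c (distinctB⇒complete π d c) })
      t1 : lookup y (suc p1) ≤ lookup y zero
      t1 = subst₂ _≤_ (sym (lookup-y p1)) (sym (trans (lookup-∸v e N zero) (cong (e0 ∸_) lookup-numerator-zero-first)))
          (ℕP.∸-monoˡ-≤ (numExp p1) x≤)

-- With key = colour, a ≺ b is the paper's order a^c < b^d, so Des_A = ∅ says the window is ≺-sorted;
-- with key = x it lists [n] by decreasing x, which is what a staircase forces on π.
module ByKey {n : ℕ} (key : Fin n → ℕ) where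

  _≺_ : Fin n → Fin n → Set
  a ≺ b = key b < key a ⊎ (key a ≡ key b × toℕ a < toℕ b)

  ≺-irrefl : ∀ {a} → ¬ a ≺ a
  ≺-irrefl (inj₁ lt) = ℕP.<-irrefl refl lt
  ≺-irrefl (inj₂ (_ , lt)) = ℕP.<-irrefl refl lt

  ≺-trans : ∀ {a b c} → a ≺ b → b ≺ c → a ≺ c
  ≺-trans (inj₁ x) (inj₁ y) = inj₁ (ℕP.<-trans y x)
  ≺-trans {a} (inj₁ x) (inj₂ (e , _)) = inj₁ (subst (_< key a) e x)
  ≺-trans {c = c} (inj₂ (e , _)) (inj₁ y) = inj₁ (subst (key c <_) (sym e) y)
  ≺-trans (inj₂ (e , x)) (inj₂ (e' , y)) = inj₂ (trans e e' , ℕP.<-trans x y)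

  ≺-tri : ∀ a b → a ≢ b → a ≺ b ⊎ b ≺ a
  ≺-tri a b ne with ℕP.<-cmp (key a) (key b)
  ... | tri< lt _ _ = inj₂ (inj₁ lt)
  ... | tri> _ _ gt = inj₁ (inj₁ gt)
  ... | tri≈ _ eq _ with ℕP.<-cmp (toℕ a) (toℕ b)
  ...   | tri< lt _ _ = inj₁ (inj₂ (eq , lt))
  ...   | tri≈ _ e _ = ⊥-elim (ne (FinP.toℕ-injective e))
  ...   | tri> _ _ gt = inj₂ (inj₂ (sym eq , gt))

  _≺?_ : ∀ a b → Dec (a ≺ b)
  a ≺? b with key b ℕP.<? key a
  ... | yes p = yes (inj₁ p)
  ... | no np with key a ℕP.≟ key b | toℕ a ℕP.<? toℕ b
  ...   | yes e | yes lt = yes (inj₂ (e , lt))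
  ...   | no ne | _ = no (λ { (inj₁ p) → np p ; (inj₂ (e , _)) → ne e })
  ...   | yes _ | no nl = no (λ { (inj₁ p) → np p ; (inj₂ (_ , lt)) → nl lt })

  Sorted : List (Fin n) → Set
  Sorted [] = ⊤
  Sorted (a ∷ l) = (∀ c → memB c l ≡ true → a ≺ c) × Sorted l

  Linked : List (Fin n) → Set
  Linked [] = ⊤
  Linked (a ∷ []) = ⊤
  Linked (a ∷ b ∷ l) = a ≺ b × Linked (b ∷ l)

  linked⇒sorted : ∀ l → Linked l → Sorted l
  linked⇒sorted [] _ = tt
  linked⇒sorted (a ∷ []) _ = (λ c ()) , tt
  linked⇒sorted (a ∷ b ∷ l) (ab , lk) with linked⇒sorted (b ∷ l) lk
  ... | (hb , sl) = (λ c m → case c (memB-∷-true c b l m)) , (hb , sl)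
    where
    case : ∀ c → (c ≡ b) ⊎ (memB c l ≡ true) → a ≺ c
    case c (inj₁ refl) = ab
    case c (inj₂ m) = ≺-trans ab (hb c m)

  sorted⇒linked : ∀ l → Sorted l → Linked l
  sorted⇒linked [] _ = tt
  sorted⇒linked (a ∷ []) _ = tt
  sorted⇒linked (a ∷ b ∷ l) (h , s) = h b (memB-here b l) , sorted⇒linked (b ∷ l) s

  sorted⇒distinct : ∀ l → Sorted l → distinctB l ≡ true
  sorted⇒distinct [] _ = refl
  sorted⇒distinct (a ∷ l) (h , s) with memB a l in eq
  ... | true = ⊥-elim (≺-irrefl (h a eq))
  ... | false = sorted⇒distinct l s

  sorted-unique : ∀ l l' → Sorted l → Sorted l' → (∀ c → memB c l ≡ memB c l') → l ≡ l'
  sorted-unique [] [] _ _ _ = refl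
  sorted-unique [] (b ∷ l') _ _ h = ⊥-elim (true≢false (trans (sym (memB-here b l')) (sym (h b))))
  sorted-unique (a ∷ l) [] _ _ h = ⊥-elim (true≢false (trans (sym (memB-here a l)) (h a)))
  sorted-unique (a ∷ l) (b ∷ l') (ha , sl) (hb , sl') h = cong₂ _∷_ ab (sorted-unique l l' sl sl' tails)
    where
    ab : a ≡ b
    ab with a Fin.≟ b
    ... | yes e = e
    ... | no ne = ⊥-elim (≺-irrefl (≺-trans (hb a aIn) (ha b bIn)))
      where
      aIn : memB a l' ≡ true
      aIn = trans (sym (memB-≢ a b l' ne)) (trans (sym (h a)) (memB-here a l))
      bIn : memB b l ≡ true
      bIn = trans (sym (memB-≢ b a l (λ e → ne (sym e)))) (trans (h b) (memB-here b l'))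
    tails : ∀ c → memB c l ≡ memB c l'
    tails c with c Fin.≟ a
    ... | yes refl = trans (≢true⇒≡false (λ m → ≺-irrefl (ha c m)))
        (sym (≢true⇒≡false (λ m → ≺-irrefl (subst (λ z → z ≺ c) (sym ab) (hb c m)))))
    ... | no ne = trans (sym (memB-≢ c a l ne)) (trans (h c) (memB-≢ c b l' (λ e → ne (trans e (sym ab)))))

  insert : ∀ {k} → Fin n → Vec (Fin n) k → Vec (Fin n) (suc k)
  insert a [] = a ∷ []
  insert a (b ∷ v) = if does (a ≺? b) then a ∷ b ∷ v else b ∷ insert a v

  isort : ∀ {k} → Vec (Fin n) k → Vec (Fin n) k
  isort [] = []
  isort (a ∷ v) = insert a (isort v)

  ∨-swap : ∀ a b c → a ∨ (b ∨ c) ≡ b ∨ (a ∨ c)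
  ∨-swap true b c = sym (BP.∨-zeroʳ b)
  ∨-swap false b c = refl

  memB-insert : ∀ {k} c a (v : Vec (Fin n) k) → memB c (toList (insert a v)) ≡ memB c (a ∷ toList v)
  memB-insert c a [] = refl
  memB-insert c a (b ∷ v) with does (a ≺? b)
  ... | true = refl
  ... | false = trans (cong (does (c Fin.≟ b) ∨_) (memB-insert c a v))
      (∨-swap (does (c Fin.≟ b)) (does (c Fin.≟ a)) (memB c (toList v)))

  sorted-insert : ∀ {k} a (v : Vec (Fin n) k) → memB a (toList v) ≡ false → Sorted (toList v) → Sorted (toList (insert a v))
  sorted-insert a [] _ _ = (λ c ()) , tt
  sorted-insert a (b ∷ v) nm (hb , sv) with a ≺? b
  ... | yes ab = (λ c m → case c (memB-∷-true c b (toList v) m)) , (hb , sv)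
    where
    case : ∀ c → (c ≡ b) ⊎ (memB c (toList v) ≡ true) → a ≺ c
    case c (inj₁ refl) = ab
    case c (inj₂ m) = ≺-trans ab (hb c m)
  ... | no nab = (λ c m → case c (memB-∷-true c a (toList v) (trans (sym (memB-insert c a v)) m)))
               , sorted-insert a v (memB-false-tail a b (toList v) nm) sv
    where
    ba : b ≺ a
    ba with ≺-tri a b (memB-false⇒≢ a b (toList v) nm)
    ... | inj₁ x = ⊥-elim (nab x)
    ... | inj₂ y = y
    case : ∀ c → (c ≡ a) ⊎ (memB c (toList v) ≡ true) → b ≺ c
    case c (inj₁ refl) = ba
    case c (inj₂ m) = hb c m

  memB-isort : ∀ {k} c (v : Vec (Fin n) k) → memB c (toList (isort v)) ≡ memB c (toList v)
  memB-isort c [] = refl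
  memB-isort c (a ∷ v) = trans (memB-insert c a (isort v)) (cong (does (c Fin.≟ a) ∨_) (memB-isort c v))

  sorted-isort : ∀ {k} (v : Vec (Fin n) k) → distinctB (toList v) ≡ true → Sorted (toList (isort v))
  sorted-isort [] _ = tt
  sorted-isort (a ∷ v) d = sorted-insert a (isort v) (trans (memB-isort a v) (distinctB-head a (toList v) d))
      (sorted-isort v (distinctB-tail a (toList v) d))

-- Colourings in I_{r,n}

module Colouring (n r' : ℕ) where
  r = suc r'

  negCol<r : ∀ c → c < r → negCol r c < r
  negCol<r zero _ = s≤s z≤n
  negCol<r (suc c) lt = ℕP.∸-monoʳ-< {r} {suc c} {0} (s≤s z≤n) (ℕP.<⇒≤ lt)

  negCol-inv : ∀ c → c < r → negCol r (negCol r c) ≡ c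
  negCol-inv zero _ = refl
  negCol-inv (suc c) lt with (r ∸ suc c) ≡ᵇ 0 in eq
  ... | true = ⊥-elim (ℕP.<-irrefl refl (ℕP.<-≤-trans lt (ℕP.m∸n≡0⇒m≤n (≡ᵇ-true⇒≡ _ 0 eq))))
  ... | false = ℕP.m∸[m∸n]≡n (ℕP.<⇒≤ lt)

  multOf : Colored n → ℕ → ℕ
  multOf w m = sumℕ (λ p → proj₂ p * ind (proj₁ p ≡ᵇ suc m)) (NNegInv r w)

  nnf : Fin n → ℕ → ℕ × ℕ
  nnf v ci = (suc (toℕ v) , negCol r ci)

  multAt : ∀ {k} → Vec (Fin n) k → Vec ℕ k → ℕ → ℕ
  multAt ρ c m = sumℕ (λ p → proj₂ p * ind (proj₁ p ≡ᵇ suc m)) (toList (zipWith nnf ρ c))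

  multAt-absent : ∀ {k} (ρ : Vec (Fin n) k) c v → memB v (toList ρ) ≡ false → multAt ρ c (toℕ v) ≡ 0
  multAt-absent [] [] v _ = refl
  multAt-absent (a ∷ ρ) (ci ∷ c) v nm = cong₂ _+_ (trans (cong (negCol r ci *_) (trans (ind-≡ᵇ-toℕ a v) z))
      (ℕP.*-zeroʳ (negCol r ci))) (multAt-absent ρ c v (memB-false-tail v a (toList ρ) nm))
    where
    z : (if does (a Fin.≟ v) then 1 else 0) ≡ 0
    z with a Fin.≟ v
    ... | yes refl = ⊥-elim (true≢false (trans (sym (memB-here a (toList ρ))) nm))
    ... | no _ = refl

  multAt-lookup : ∀ {k} (ρ : Vec (Fin n) k) c → distinctB (toList ρ) ≡ true → ∀ i → multAt ρ c (toℕ (lookup ρ i)) ≡ negCol r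
      (lookup c i)
  multAt-lookup (a ∷ ρ) (ci ∷ c) d zero = trans (cong₂ _+_
      (trans (cong (negCol r ci *_) (cong ind (≡ᵇ-refl (toℕ a)))) (ℕP.*-identityʳ _))
                                        (multAt-absent ρ c a (distinctB-head a (toList ρ) d))) (ℕP.+-identityʳ _)
  multAt-lookup (a ∷ ρ) (ci ∷ c) d (suc i) = cong₂ _+_
      (trans (cong (negCol r ci *_) (trans (ind-≡ᵇ-toℕ a (lookup ρ i)) z)) (ℕP.*-zeroʳ (negCol r ci)))
                                           (multAt-lookup ρ c (distinctB-tail a (toList ρ) d) i)
    where
    z : (if does (a Fin.≟ lookup ρ i) then 1 else 0) ≡ 0
    z with a Fin.≟ lookup ρ i
    ... | yes e = ⊥-elim (true≢false (trans (sym (subst (λ q → memB q (toList ρ) ≡ true) (sym e) (memB-lookup ρ i)))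
        (distinctB-head a (toList ρ) d)))
    ... | no _ = refl

  -- Inverts c ↦ (r − c) mod r: the colour of v is read off its multiplicity in NNeg((ρ,ε)⁻¹).
  colourOf : Colored n → Fin n → ℕ
  colourOf w v = negCol r (multOf w (toℕ v))

  ValidColouring : Colored n → Set
  ValidColouring w = distinctB (toList (proj₁ w)) ≡ true × (∀ i → lookup (proj₂ w) i < r) × isNil (DesA w) ≡ true

  colourOf-lookup : ∀ w → distinctB (toList (proj₁ w)) ≡ true → (∀ i → lookup (proj₂ w) i < r) → ∀ i → colourOf w
      (lookup (proj₁ w) i) ≡ lookup (proj₂ w) i
  colourOf-lookup (ρ , c) d cr i = trans (cong (negCol r) (multAt-lookup ρ c d i)) (negCol-inv (lookup c i) (cr i))

  isNil-if : ∀ s b l → b ≡ false → isNil ((if b then [ s ] else []) ++ l) ≡ isNil l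
  isNil-if s false l _ = refl

  isNil-if⇒ : ∀ s b l → isNil ((if b then [ s ] else []) ++ l) ≡ true → b ≡ false × isNil l ≡ true
  isNil-if⇒ s false l h = refl , h
  isNil-if⇒ s true l ()

  module DesAByKey (key : Fin n → ℕ) where
    open ByKey key
    gt⇒≺ : ∀ j k → j ≢ k → gtPair (j , key j) (k , key k) ≡ false → j ≺ k
    gt⇒≺ j k ne h with key j <ᵇ key k in e1
    ... | true = ⊥-elim (true≢false h)
    ... | false with ℕP.m≤n⇒m<n∨m≡n (<ᵇ-false⇒≥ (key j) (key k) e1)
    ...   | inj₁ lt = inj₁ lt
    ...   | inj₂ eq = inj₂ (sym eq , lt')
      where
      eqT : (key j ≡ᵇ key k) ≡ true
      eqT = subst (λ z → (key j ≡ᵇ z) ≡ true) (sym eq) (≡ᵇ-refl (key j))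
      h' : (toℕ k <ᵇ toℕ j) ≡ false
      h' = trans (cong (λ z → z ∧ (toℕ k <ᵇ toℕ j)) (sym eqT)) h
      le : toℕ j ≤ toℕ k
      le = <ᵇ-false⇒≥ (toℕ k) (toℕ j) h'
      lt' : toℕ j < toℕ k
      lt' with ℕP.m≤n⇒m<n∨m≡n le
      ... | inj₁ l = l
      ... | inj₂ e = ⊥-elim (ne (FinP.toℕ-injective e))

    ≺⇒gt : ∀ j k → j ≺ k → gtPair (j , key j) (k , key k) ≡ false
    ≺⇒gt j k (inj₁ lt) rewrite <ᵇ-false (key j) (key k) (ℕP.<⇒≤ lt)
                             | ≡ᵇ-false (key j) (key k) (λ e → ℕP.<-irrefl (sym e) lt) = refl
    ≺⇒gt j k (inj₂ (eq , lt)) rewrite eq | <ᵇ-false (key k) (key k) ℕP.≤-refl | ≡ᵇ-refl (key k)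
                                    | <ᵇ-false (toℕ k) (toℕ j) (ℕP.<⇒≤ lt) = refl

    desA-nil⇒linked : ∀ s (l : List (Fin n)) → distinctB l ≡ true → isNil
        (desAFrom s (List.map (λ v → (v , key v)) l)) ≡ true → Linked l
    desA-nil⇒linked s [] _ _ = tt
    desA-nil⇒linked s (a ∷ []) _ _ = tt
    desA-nil⇒linked s (a ∷ b ∷ l) d h = gt⇒≺ a b (memB-false⇒≢ a b l (distinctB-head a (b ∷ l) d))
        (proj₁ X) , desA-nil⇒linked (suc s) (b ∷ l) (distinctB-tail a (b ∷ l) d) (proj₂ X)
      where X = isNil-if⇒ s (gtPair (a , key a) (b , key b)) _ h

    linked⇒desA-nil : ∀ s (l : List (Fin n)) → Linked l → isNil (desAFrom s (List.map (λ v → (v , key v)) l)) ≡ true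
    linked⇒desA-nil s [] _ = refl
    linked⇒desA-nil s (a ∷ []) _ = refl
    linked⇒desA-nil s (a ∷ b ∷ l) (ab , lk) = trans (isNil-if s (gtPair (a , key a) (b , key b)) _ (≺⇒gt a b ab))
        (linked⇒desA-nil (suc s) (b ∷ l) lk)

  linked-cong : ∀ (k1 k2 : Fin n → ℕ) → (∀ v → k1 v ≡ k2 v) → ∀ l → ByKey.Linked k1 l → ByKey.Linked k2 l
  linked-cong k1 k2 eq [] _ = tt
  linked-cong k1 k2 eq (a ∷ []) _ = tt
  linked-cong k1 k2 eq (a ∷ b ∷ l) (ab , lk) = tr ab , linked-cong k1 k2 eq (b ∷ l) lk
    where
    tr : ByKey._≺_ k1 a b → ByKey._≺_ k2 a b
    tr (inj₁ lt) = inj₁ (subst₂ _<_ (eq b) (eq a) lt)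
    tr (inj₂ (e , lt)) = inj₂ (trans (sym (eq a)) (trans e (eq b)) , lt)

  zip-colourOf : ∀ {k} (key : Fin n → ℕ) (ρ : Vec (Fin n) k) (c : Vec ℕ k) → (∀ i → lookup c i ≡ key (lookup ρ i)) →
    toList (zip ρ c) ≡ List.map (λ v → (v , key v)) (toList ρ)
  zip-colourOf key [] [] h = refl
  zip-colourOf key (a ∷ ρ) (ci ∷ c) h = cong₂ _∷_ (cong (a ,_) (h zero)) (zip-colourOf key ρ c (h ∘ suc))

  valid⇒linked : ∀ w → ValidColouring w → ByKey.Linked (colourOf w) (toList (proj₁ w))
  valid⇒linked (ρ , c) (d , cr , dn) = DesAByKey.desA-nil⇒linked (colourOf (ρ , c)) 1 (toList ρ) d
     (subst (λ z → isNil (desAFrom 1 z) ≡ true) (zip-colourOf (colourOf (ρ , c)) ρ c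
         (λ i → sym (colourOf-lookup (ρ , c) d cr i))) dn)

  valid-unique : ∀ w w' → ValidColouring w → ValidColouring w' → (∀ m → m < n → multOf w m ≡ multOf w' m) → w ≡ w'
  valid-unique (ρ , c) (ρ' , c') vw@(d , cr , _) vw'@(d' , cr' , _) eqN = cong₂ _,_ ρ≡ c≡
    where
    w = (ρ , c)
    w' = (ρ' , c')
    colour≡ : ∀ v → colourOf w v ≡ colourOf w' v
    colour≡ v = cong (negCol r) (eqN (toℕ v) (FinP.toℕ<n v))
    s1 : ByKey.Sorted (colourOf w) (toList ρ)
    s1 = ByKey.linked⇒sorted (colourOf w) (toList ρ) (valid⇒linked w vw)
    s2 : ByKey.Sorted (colourOf w) (toList ρ')
    s2 = ByKey.linked⇒sorted (colourOf w) (toList ρ')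
        (linked-cong (colourOf w') (colourOf w) (λ v → sym (colour≡ v)) (toList ρ') (valid⇒linked w' vw'))
    ρ≡ : ρ ≡ ρ'
    ρ≡ = toList-injective ρ ρ' (ByKey.sorted-unique (colourOf w) (toList ρ) (toList ρ') s1 s2
            (λ v → trans (distinctB⇒complete ρ d v) (sym (distinctB⇒complete ρ' d' v))))
    c≡ : c ≡ c'
    c≡ = ≡-from-lookup c c' (λ i → trans (sym (colourOf-lookup w d cr i))
        (trans (colour≡ (lookup ρ i)) (trans (cong (λ z → colourOf w' (lookup z i)) ρ≡) (colourOf-lookup w' d' cr' i))))

module ColouringFromMultiplicities (n r' : ℕ) (μ : ℕ → ℕ) (μ<r : ∀ m → μ m < suc r') where
  open Colouring n r'

  colour* : Fin n → ℕ
  colour* v = negCol r (μ (toℕ v))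
  ρ* : Vec (Fin n) n
  ρ* = ByKey.isort colour* (Vec.allFin n)
  c* : Vec ℕ n
  c* = Vec.map colour* ρ*
  w* : Colored n
  w* = (ρ* , c*)

  sortedρ : ByKey.Sorted colour* (toList ρ*)
  sortedρ = ByKey.sorted-isort colour* (Vec.allFin n) (distinctB-allFinVec n)

  dρ : distinctB (toList ρ*) ≡ true
  dρ = ByKey.sorted⇒distinct colour* (toList ρ*) sortedρ

  cr : ∀ i → lookup c* i < r
  cr i = subst (_< r) (sym (VP.lookup-map i colour* ρ*)) (negCol<r _ (μ<r _))

  valid : ValidColouring w*
  valid = dρ , cr , subst (λ z → isNil (desAFrom 1 z) ≡ true)
      (sym (zip-colourOf colour* ρ* c* (λ i → VP.lookup-map i colour* ρ*)))
    (DesAByKey.linked⇒desA-nil colour* 1 (toList ρ*) (ByKey.sorted⇒linked colour* (toList ρ*) sortedρ))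

  multOf-w* : ∀ m → m < n → multOf w* m ≡ μ m
  multOf-w* m lt with memB⇒lookup ρ* (Fin.fromℕ< lt) (distinctB⇒complete ρ* dρ (Fin.fromℕ< lt))
  ... | i , e = begin
      multOf w* m ≡⟨ cong (multOf w*) (sym tm) ⟩
      multAt ρ* c* (toℕ (lookup ρ* i)) ≡⟨ multAt-lookup ρ* c* dρ i ⟩
      negCol r (lookup c* i) ≡⟨ cong (negCol r) (VP.lookup-map i colour* ρ*) ⟩
      negCol r (colour* (lookup ρ* i)) ≡⟨ negCol-inv _ (μ<r _) ⟩
      μ (toℕ (lookup ρ* i)) ≡⟨ cong μ tm ⟩
      μ m ∎
    where
    open ≡-Reasoning
    tm : toℕ (lookup ρ* i) ≡ m
    tm = trans (cong toℕ e) (FinP.toℕ-fromℕ< lt)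

-- The contributing summand

distinct-suffix : ∀ {n} (pre S : List (Fin n)) → distinctB (pre ++ S) ≡ true → distinctB S ≡ true
distinct-suffix [] S d = d
distinct-suffix (a ∷ pre) S d = distinct-suffix pre S (distinctB-tail a (pre ++ S) d)

mod-unique : ∀ r' a b s s' → a < suc r' → b < suc r' → a + suc r' * s ≡ b + suc r' * s' → a ≡ b
mod-unique r' a b s s' la lb eq = begin
    a ≡⟨ sym (m<n⇒m%n≡m la) ⟩
    a % suc r' ≡⟨ sym ([m+kn]%n≡m%n a s (suc r')) ⟩
    (a + s * suc r') % suc r' ≡⟨ cong (λ z → (a + z) % suc r') (ℕP.*-comm s (suc r')) ⟩
    (a + suc r' * s) % suc r' ≡⟨ cong (_% suc r') eq ⟩
    (b + suc r' * s') % suc r' ≡⟨ cong (λ z → (b + z) % suc r') (ℕP.*-comm (suc r') s') ⟩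
    (b + s' * suc r') % suc r' ≡⟨ [m+kn]%n≡m%n b s' (suc r') ⟩
    b % suc r' ≡⟨ m<n⇒m%n≡m lb ⟩
    b ∎
  where open ≡-Reasoning

ind≡0⇒false : ∀ b → ind b ≡ 0 → b ≡ false
ind≡0⇒false false _ = refl

module SortedSummand (n' r' : ℕ) (p1 : Fin (suc n')) (πr : Vec (Fin (suc n')) n') (d : distinctB (toList (p1 ∷ πr)) ≡ true)
             (e : Exp (suc (suc n'))) where
  n = suc n'
  r = suc r'
  π : Vec (Fin n) n
  π = p1 ∷ πr
  L = toList π
  x : Fin n → ℕ
  x c = lookup e (suc c)
  e0 = lookup e zero
  open ByKey x
  open Colouring n r' using (multOf; ValidColouring; multAt; multAt-lookup; negCol<r)

  occ-Des : ∀ pre p q t → L ≡ pre ++ p ∷ q ∷ t → occ (suc (length pre)) (Des π) ≡ ind (toℕ q <ᵇ toℕ p)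
  occ-Des pre p q t eq = trans (cong (λ z → occ (suc (length pre)) (desFrom 1 z)) eq) (occ-desFrom-position 1 pre p q t)

  occ-Des-last : ∀ pre p → L ≡ pre ++ p ∷ [] → occ (suc (length pre)) (Des π) ≡ 0
  occ-Des-last pre p eq = trans (cong (λ z → occ (suc (length pre)) (desFrom 1 z)) eq) (occ-desFrom-last pre p)

  module OfColouring (w : Colored n) where
    open SummandSupport n' r' p1 πr w e public using (Staircase; Good)
    open Numerator n r π w using (stepExp; nnegMult)

    staircase⇒linked : ∀ pre p rest → L ≡ pre ++ p ∷ rest → Staircase (length pre) (p ∷ rest) → Linked (p ∷ rest)
    staircase⇒linked pre p [] eq _ = tt
    staircase⇒linked pre p (q ∷ t) eq ((s , h) , gc) = pq ,
        (staircase⇒linked (pre ++ [ p ]) q t (split-next pre eq)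
            (subst (λ z → Staircase z (q ∷ t)) (sym (length-snoc pre p)) gc))
      where
      m = length pre
      dS : distinctB (p ∷ q ∷ t) ≡ true
      dS = distinct-suffix pre (p ∷ q ∷ t) (subst (λ z → distinctB z ≡ true) eq d)
      pq≠ : p ≢ q
      pq≠ = memB-false⇒≢ p q t (distinctB-head p (q ∷ t) dS)
      h' : x p ≡ x q + (ind (toℕ q <ᵇ toℕ p) + nnegMult m) + r * s
      h' = trans h (cong (λ z → x q + (z + nnegMult m) + r * s) (occ-Des pre p q t eq))
      le : x q ≤ x p
      le = subst (x q ≤_) (sym h') (ℕP.≤-trans (ℕP.m≤m+n (x q) _) (ℕP.m≤m+n _ (r * s)))
      pq : p ≺ q
      pq with ℕP.m≤n⇒m<n∨m≡n le
      ... | inj₁ lt = inj₁ lt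
      ... | inj₂ e' = inj₂ (sym e' , lt')
        where
        z0 : ind (toℕ q <ᵇ toℕ p) + nnegMult m + r * s ≡ 0
        z0 = ℕP.+-cancelˡ-≡ (x q) _ 0 (trans (sym (trans (ℕP.+-assoc (x q) _ (r * s)) refl))
            (trans (sym h') (trans (sym e') (sym (ℕP.+-identityʳ (x q))))))
        iz : ind (toℕ q <ᵇ toℕ p) ≡ 0
        iz = ℕP.m+n≡0⇒m≡0 _ (ℕP.m+n≡0⇒m≡0 _ z0)
        lt' : toℕ p < toℕ q
        lt' with ℕP.m≤n⇒m<n∨m≡n (<ᵇ-false⇒≥ (toℕ q) (toℕ p) (ind≡0⇒false _ iz))
        ... | inj₁ l = l
        ... | inj₂ e'' = ⊥-elim (pq≠ (FinP.toℕ-injective e''))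

    good⇒sorted : Good → Sorted L
    good⇒sorted (_ , gc) = linked⇒sorted L (staircase⇒linked [] p1 (toList πr) refl gc)

    good⇒bounded : Good → ∀ c → x c ≤ e0
    good⇒bounded g@(le , _) c with good⇒sorted g
    ... | (hd , _) with c Fin.≟ p1
    ...   | yes refl = le
    ...   | no ne with hd c (trans (sym (memB-≢ c p1 (toList πr) ne)) (distinctB⇒complete π d c))
    ...     | inj₁ lt = ℕP.≤-trans (ℕP.<⇒≤ lt) le
    ...     | inj₂ (eqk , _) = subst (_≤ e0) eqk le

  multOf<r : ∀ w → ValidColouring w → ∀ m → m < n → multOf w m < r
  multOf<r (ρ , c) (dρ , cr , _) m lt with memB⇒lookup ρ (Fin.fromℕ< lt) (distinctB⇒complete ρ dρ (Fin.fromℕ< lt))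
  ... | i , eq = subst (_< r) (trans (sym (multAt-lookup ρ c dρ i))
      (cong (multAt ρ c) (trans (cong toℕ eq) (FinP.toℕ-fromℕ< lt)))) (negCol<r (lookup c i) (cr i))

  module TwoColourings (w w' : Colored n) (vw : ValidColouring w) (vw' : ValidColouring w') where
    module A = OfColouring w
    module B = OfColouring w'

    multiplicities-agree : ∀ pre p rest → L ≡ pre ++ p ∷ rest → A.Staircase (length pre) (p ∷ rest) → B.Staircase
        (length pre) (p ∷ rest) →
      ∀ k → length pre ≤ k → k < n → multOf w k ≡ multOf w' k
    multiplicities-agree pre p rest eq ga gb k le lt with ℕP.m≤n⇒m<n∨m≡n le
    multiplicities-agree pre p [] eq (s , h) (s' , h') k le lt | inj₂ refl =
      mod-unique r' _ _ s s' (multOf<r w vw k lt) (multOf<r w' vw' k lt)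
        (ℕP.+-cancelˡ-≡ (occ (suc k) (Des π)) _ _ (trans (sym (ℕP.+-assoc (occ (suc k) (Des π)) (multOf w k) (r * s)))
            (trans (sym h) (trans h' (ℕP.+-assoc (occ (suc k) (Des π)) (multOf w' k) (r * s'))))))
    multiplicities-agree pre p (q ∷ t) eq ((s , h) , _) ((s' , h') , _) k le lt | inj₂ refl =
      mod-unique r' _ _ s s' (multOf<r w vw k lt) (multOf<r w' vw' k lt)
        (ℕP.+-cancelˡ-≡ (x q + occ (suc k) (Des π)) _ _
            (trans (sym (a4 (x q) (occ (suc k) (Des π)) (multOf w k) (r * s)))
                (trans (sym h) (trans h' (a4 (x q) (occ (suc k) (Des π)) (multOf w' k) (r * s'))))))
      where
      a4 : ∀ a b c d → a + (b + c) + d ≡ a + b + (c + d)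
      a4 a b c d = trans (cong (_+ d) (sym (ℕP.+-assoc a b c))) (ℕP.+-assoc (a + b) c d)
    multiplicities-agree pre p [] eq ga gb k le lt | inj₁ lt' = ⊥-elim (ℕP.<-irrefl lp (ℕP.<-≤-trans lt' (ℕP.≤-pred lt)))
      where
      lp : length pre ≡ n'
      lp = ℕP.suc-injective (trans (trans (ℕP.+-comm 1 (length pre)) (sym (LP.length-++ pre {[ p ]})))
          (trans (cong length (sym eq)) (VP.length-toList π)))
    multiplicities-agree pre p (q ∷ t) eq (_ , ga) (_ , gb) k le lt | inj₁ lt' =
      multiplicities-agree (pre ++ [ p ]) q t (split-next pre eq)
        (subst (λ z → A.Staircase z (q ∷ t)) (sym (length-snoc pre p)) ga)
            (subst (λ z → B.Staircase z (q ∷ t)) (sym (length-snoc pre p)) gb) k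
                (subst (_≤ k) (sym (length-snoc pre p)) lt') lt

    colouring-unique : A.Good → B.Good → w ≡ w'
    colouring-unique (_ , ga) (_ , gb) = Colouring.valid-unique n r' w w' vw vw'
        (λ m lt → multiplicities-agree [] p1 (toList πr) refl ga gb m z≤n lt)

  -- The multiplicities a good colouring must have: each staircase step, minus its descent indicator, mod r.
  forcedMult : List (Fin n) → ℕ → ℕ
  forcedMult [] _ = 0
  forcedMult (p ∷ t) (suc m) = forcedMult t m
  forcedMult (p ∷ []) zero = x p % r
  forcedMult (p ∷ q ∷ t) zero = (x p ∸ (x q + ind (toℕ q <ᵇ toℕ p))) % r

  forcedMult<r : ∀ l m → forcedMult l m < r
  forcedMult<r [] _ = s≤s z≤n
  forcedMult<r (p ∷ t) (suc m) = forcedMult<r t m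
  forcedMult<r (p ∷ []) zero = m%n<n (x p) r
  forcedMult<r (p ∷ q ∷ t) zero = m%n<n (x p ∸ (x q + ind (toℕ q <ᵇ toℕ p))) r

  forcedMult-shift : ∀ (pre S : List (Fin n)) k → forcedMult (pre ++ S) (length pre + k) ≡ forcedMult S k
  forcedMult-shift [] S k = refl
  forcedMult-shift (a ∷ pre) S k = forcedMult-shift pre S k

  module Construct (w : Colored n) (hw : ∀ m → m < n → multOf w m ≡ forcedMult L m) where
    open OfColouring w
    open Numerator n r π w using (stepExp; nnegMult)

    position<n : ∀ pre p rest → L ≡ pre ++ p ∷ rest → length pre < n
    position<n pre p rest eq = subst (length pre <_) (trans (cong length (sym eq)) (VP.length-toList π))
      (subst (length pre <_) (sym (LP.length-++ pre {p ∷ rest})) (ℕP.m<m+n (length pre) (s≤s z≤n)))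

    forcedMult-at : ∀ pre p rest → L ≡ pre ++ p ∷ rest → nnegMult (length pre) ≡ forcedMult (p ∷ rest) 0
    forcedMult-at pre p rest eq = trans (hw (length pre) (position<n pre p rest eq))
       (trans (cong (λ z → forcedMult z (length pre)) eq)
           (trans (cong (forcedMult (pre ++ p ∷ rest)) (sym (ℕP.+-identityʳ (length pre))))
               (forcedMult-shift pre (p ∷ rest) 0)))

    sol : ∀ a b c d r → a + b + (c + d * r) ≡ a + (b + c) + r * d
    sol = solve 5 (λ a b c d r → a :+ b :+ (c :+ d :* r) := a :+ (b :+ c) :+ r :* d) refl

    construct-staircase : ∀ pre p rest → L ≡ pre ++ p ∷ rest → Linked (p ∷ rest) → Staircase (length pre) (p ∷ rest)
    construct-staircase pre p [] eq _ = (x p / r) , (begin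
        x p ≡⟨ m≡m%n+[m/n]*n (x p) r ⟩
        x p % r + (x p / r) * r ≡⟨ cong₂ _+_ (sym (trans (cong (_+ nnegMult (length pre)) (occ-Des-last pre p eq))
            (forcedMult-at pre p [] eq))) (ℕP.*-comm (x p / r) r) ⟩
        stepExp (length pre) + r * (x p / r) ∎)
      where open ≡-Reasoning
    construct-staircase pre p (q ∷ t) eq (pq , lk) = ((D / r) , (begin
        x p ≡⟨ sym (ℕP.m+[n∸m]≡n le) ⟩
        (x q + i) + D ≡⟨ cong ((x q + i) +_) (m≡m%n+[m/n]*n D r) ⟩
        (x q + i) + (D % r + (D / r) * r) ≡⟨ sol (x q) i (D % r) (D / r) r ⟩
        x q + (i + D % r) + r * (D / r) ≡⟨ cong (λ z → x q + z + r * (D / r))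
            (sym (cong₂ _+_ (occ-Des pre p q t eq) (forcedMult-at pre p (q ∷ t) eq))) ⟩
        x q + stepExp (length pre) + r * (D / r) ∎))
      , subst (λ z → Staircase z (q ∷ t)) (length-snoc pre p) (construct-staircase (pre ++ [ p ]) q t (split-next pre eq) lk)
      where
      open ≡-Reasoning
      i = ind (toℕ q <ᵇ toℕ p)
      D = x p ∸ (x q + i)
      i≤1 : ∀ b → ind b ≤ 1
      i≤1 true = ℕP.≤-refl
      i≤1 false = z≤n
      leH : p ≺ q → x q + i ≤ x p
      leH (inj₁ lt) = ℕP.≤-trans (ℕP.+-monoʳ-≤ (x q) (i≤1 (toℕ q <ᵇ toℕ p))) (subst (_≤ x p) (ℕP.+-comm 1 (x q)) lt)
      leH (inj₂ (e' , lt)) = subst (_≤ x p) (sym (trans (cong (x q +_) (cong ind (<ᵇ-false (toℕ q) (toℕ p) (ℕP.<⇒≤ lt))))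
          (ℕP.+-identityʳ (x q))))
                               (ℕP.≤-reflexive (sym e'))
      le : x q + i ≤ x p
      le = leH pq

countEq : ∀ {A : Set} → DecidableEquality A → A → List A → ℕ
countEq _≟_ a [] = 0
countEq _≟_ a (y ∷ L) = ind (does (y ≟ a)) + countEq _≟_ a L

sumℤ-count : ∀ {A : Set} (_≟_ : DecidableEquality A) (h : A → ℤ) a L → All (λ y → y ≢ a → h y ≡ 0ℤ) L →
  sumℤ (map h L) ≡ ℤ.+ (countEq _≟_ a L) *ℤ h a
sumℤ-count _≟_ h a [] [] = sym (ℤP.*-zeroˡ (h a))
sumℤ-count _≟_ h a (y ∷ L) (p ∷ ps) with y ≟ a
... | yes refl = trans (cong (h y +ℤ_) (sumℤ-count _≟_ h a L ps))
   (trans (cong (_+ℤ (ℤ.+ (countEq _≟_ a L) *ℤ h a)) (sym (ℤP.*-identityˡ (h a))))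
          (sym (ℤP.*-distribʳ-+ (h a) 1ℤ (ℤ.+ countEq _≟_ a L))))
... | no ne = trans (cong₂ _+ℤ_ (p ne) (sumℤ-count _≟_ h a L ps)) (ℤP.+-identityˡ _)

sumℤ-zero : ∀ {A : Set} (h : A → ℤ) L → All (λ y → h y ≡ 0ℤ) L → sumℤ (map h L) ≡ 0ℤ
sumℤ-zero h [] [] = refl
sumℤ-zero h (y ∷ L) (p ∷ ps) = cong₂ _+ℤ_ p (sumℤ-zero h L ps)

Iverson-sumℤ : ∀ {A : Set} (_≟_ : DecidableEquality A) (L : List A) (D G : A → Set) (f : A → ℤ) →
  All D L → (∀ a → D a → Iverson (G a) (f a)) → (P : Set) →
  (P → Σ A λ a → D a × G a × countEq _≟_ a L ≡ 1) → (∀ a → D a → G a → P) →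
  (∀ a b → D a → D b → G a → G b → a ≡ b) → Iverson P (sumℤ (map f L))
Iverson-sumℤ _≟_ L D G f all-D f≡[G] P witness witness-of unique = sum≡1 , sum≡0
  where
  sum≡1 : P → sumℤ (map f L) ≡ 1ℤ
  sum≡1 p with witness p
  ... | a* , d* , g* , count≡1 = begin
      sumℤ (map f L)
    ≡⟨ sumℤ-count _≟_ f a* L (All.map (λ {a} d a≢a* → proj₂ (f≡[G] a d) (λ g → a≢a* (unique a a* d d* g g*))) all-D) ⟩
      ℤ.+ (countEq _≟_ a* L) *ℤ f a*
    ≡⟨ cong₂ (λ k v → ℤ.+ k *ℤ v) count≡1 (proj₁ (f≡[G] a* d*) g*) ⟩
      1ℤ ∎
    where open ≡-Reasoning
  sum≡0 : ¬ P → sumℤ (map f L) ≡ 0ℤ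
  sum≡0 ¬p = sumℤ-zero f L (All.map (λ {a} d → proj₂ (f≡[G] a d) (¬p ∘ witness-of a d)) all-D)

countEq-filter : ∀ {A : Set} (_≟_ : DecidableEquality A) {P : Pred A 0ℓ} (P? : Decidable P) a L → P a →
  countEq _≟_ a (filter P? L) ≡ countEq _≟_ a L
countEq-filter _≟_ P? a [] pa = refl
countEq-filter _≟_ P? a (y ∷ L) pa with P? y
... | true because _ = cong (ind (does (y ≟ a)) +_) (countEq-filter _≟_ P? a L pa)
... | false because ofⁿ ¬py with y ≟ a
...   | yes refl = ⊥-elim (¬py pa)
...   | no _ = countEq-filter _≟_ P? a L pa

countEq-++ : ∀ {A : Set} (_≟_ : DecidableEquality A) a (xs ys : List A) →
  countEq _≟_ a (xs ++ ys) ≡ countEq _≟_ a xs + countEq _≟_ a ys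
countEq-++ _≟_ a [] ys = refl
countEq-++ _≟_ a (y ∷ xs) ys =
  trans (cong (ind (does (y ≟ a)) +_) (countEq-++ _≟_ a xs ys)) (sym (ℕP.+-assoc (ind (does (y ≟ a))) _ _))

countEq-absent : ∀ {A : Set} (_≟_ : DecidableEquality A) a L → All (_≢ a) L → countEq _≟_ a L ≡ 0
countEq-absent _≟_ a [] [] = refl
countEq-absent _≟_ a (y ∷ L) (y≢a ∷ ps) rewrite dec-false (y ≟ a) y≢a = countEq-absent _≟_ a L ps

countEq-concatMap-map : ∀ {A B C : Set} (_≟A_ : DecidableEquality A) (_≟B_ : DecidableEquality B)
  (_≟C_ : DecidableEquality C) (g : A → B → C) → (∀ {x u a b} → g x u ≡ g a b → x ≡ a × u ≡ b) →
  ∀ a b xs R → countEq _≟C_ (g a b) (concatMap (λ x → map (g x) R) xs) ≡ countEq _≟A_ a xs * countEq _≟B_ b R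
countEq-concatMap-map _≟A_ _≟B_ _≟C_ g g-injective a b [] R = refl
countEq-concatMap-map _≟A_ _≟B_ _≟C_ g g-injective a b (x ∷ xs) R =
  trans (countEq-++ _≟C_ (g a b) (map (g x) R) _)
    (trans (cong₂ _+_ (head-block x R) (countEq-concatMap-map _≟A_ _≟B_ _≟C_ g g-injective a b xs R))
           (sym (ℕP.*-distribʳ-+ _ (ind (does (x ≟A a))) (countEq _≟A_ a xs))))
  where
  head-block : ∀ x R → countEq _≟C_ (g a b) (map (g x) R) ≡ ind (does (x ≟A a)) * countEq _≟B_ b R
  head-block x [] = sym (ℕP.*-zeroʳ (ind (does (x ≟A a))))
  head-block x (u ∷ R) with x ≟A a | u ≟B b | head-block x R
  ... | yes refl | yes refl | IH rewrite dec-true (g a b ≟C g a b) refl = cong suc IH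
  ... | yes refl | no u≢b | IH rewrite dec-false (g a u ≟C g a b) (u≢b ∘ proj₂ ∘ g-injective) = IH
  ... | no x≢a | _ | IH rewrite dec-false (g x u ≟C g a b) (x≢a ∘ proj₁ ∘ g-injective) = IH

countEq-allVecs : ∀ {A : Set} (_≟_ : DecidableEquality A) xs k (v : Vec A k) →
  (∀ i → countEq _≟_ (lookup v i) xs ≡ 1) → countEq (VP.≡-dec _≟_) v (allVecs xs k) ≡ 1
countEq-allVecs _≟_ xs zero [] h = refl
countEq-allVecs _≟_ xs (suc k) (a ∷ v) h =
  trans (countEq-concatMap-map _≟_ (VP.≡-dec _≟_) (VP.≡-dec _≟_) _∷_ VP.∷-injective a v xs (allVecs xs k))
        (cong₂ _*_ (h zero) (countEq-allVecs _≟_ xs k v (h ∘ suc)))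

countEq-tabulate : ∀ {A : Set} (_≟_ : DecidableEquality A) {n} (f : Fin n → A) → (∀ i j → f i ≡ f j → i ≡ j) → ∀ i →
  countEq _≟_ (f i) (List.tabulate f) ≡ 1
countEq-tabulate _≟_ {suc n} f inj zero rewrite dec-true (f zero ≟ f zero) refl =
  cong suc (countEq-absent _≟_ (f zero) (List.tabulate (f ∘ suc)) (AllP.tabulate⁺ (λ j e → FinP.0≢1+n (sym (inj _ _ e)))))
countEq-tabulate _≟_ {suc n} f inj (suc i) rewrite dec-false (f zero ≟ f (suc i)) (λ e → FinP.0≢1+n (inj _ _ e)) =
  countEq-tabulate _≟_ (f ∘ suc) (λ a b e → FinP.suc-injective (inj _ _ e)) i

countEq-upTo : ∀ N i → i < N → countEq ℕP._≟_ i (upTo N) ≡ 1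
countEq-upTo N = go id (λ e → e) N
  where
  go : (f : ℕ → ℕ) → (∀ {i j} → f i ≡ f j → i ≡ j) → ∀ N i → i < N → countEq ℕP._≟_ (f i) (applyUpTo f N) ≡ 1
  go f inj (suc N) zero _ rewrite dec-true (f 0 ℕP.≟ f 0) refl =
    cong suc (countEq-absent ℕP._≟_ (f 0) (applyUpTo (f ∘ suc) N) (AllP.applyUpTo⁺₁ (f ∘ suc) N (λ _ e → ℕP.1+n≢0 (inj e))))
  go f inj (suc N) (suc i) (s≤s i<N) rewrite dec-false (f 0 ℕP.≟ f (suc i)) (ℕP.0≢1+n ∘ inj) =
    go (f ∘ suc) (ℕP.suc-injective ∘ inj) N i i<N

-- The right-hand side

allVecs-All : ∀ {A : Set} {P : A → Set} (xs : List A) k → All P xs → All (λ v → ∀ i → P (lookup v i)) (allVecs xs k)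
allVecs-All xs zero _ = (λ ()) ∷ []
allVecs-All xs (suc k) all-P = AllP.concat⁺ (AllP.map⁺ (All.map (λ px →
  AllP.map⁺ (All.map (λ h → λ { zero → px ; (suc i) → h i }) (allVecs-All xs k all-P))) all-P))

T⇒≡true : ∀ {b} → T b → b ≡ true
T⇒≡true {true} _ = refl

≡true⇒T : ∀ {b} → b ≡ true → T b
≡true⇒T refl = _

module RHSCoefficient (r' n' e0 : ℕ) (xs : Vec ℕ (suc n')) where
  r = suc r'
  n = suc n'
  e : Exp (suc n)
  e = e0 ∷ xs
  x : Fin n → ℕ
  x c = lookup xs c
  open Colouring n r' using (ValidColouring)

  Distinct : Vec (Fin n) n → Set
  Distinct π = distinctB (toList π) ≡ true

  _≟π_ : DecidableEquality (Vec (Fin n) n)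
  _≟π_ = VP.≡-dec FinP._≟_

  _≟w_ : DecidableEquality (Colored n)
  _≟w_ = ×P.≡-dec _≟π_ (VP.≡-dec ℕP._≟_)

  Good : Vec (Fin n) n → Colored n → Set
  Good (p1 ∷ πr) w = SummandSupport.Good n' r' p1 πr w e

  summand-Iverson : ∀ π → Distinct π → ∀ w → Iverson (Good π w) (rhsTerm r n π w e)
  summand-Iverson (p1 ∷ πr) d w =
    Iverson-⇔ (SummandSupport.support⇒good n' r' p1 πr w e d) (SummandSupport.good⇒support n' r' p1 πr w e d)
        (SummandFactors.rhsTerm-Iverson-support n' r' p1 πr w d e)

  good-bounded : ∀ π → Distinct π → ∀ w → Good π w → ∀ c → x c ≤ e0
  good-bounded (p1 ∷ πr) d w = SortedSummand.OfColouring.good⇒bounded n' r' p1 πr d e w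

  good-sorted : ∀ π → Distinct π → ∀ w → Good π w → ByKey.Sorted x (toList π)
  good-sorted (p1 ∷ πr) d w = SortedSummand.OfColouring.good⇒sorted n' r' p1 πr d e w

  good-permutation-unique : ∀ π π' → Distinct π → Distinct π' → ∀ w w' → Good π w → Good π' w' → π ≡ π'
  good-permutation-unique π π' d d' w w' g g' = toList-injective π π'
    (ByKey.sorted-unique x (toList π) (toList π') (good-sorted π d w g) (good-sorted π' d' w' g')
      (λ c → trans (distinctB⇒complete π d c) (sym (distinctB⇒complete π' d' c))))

  good-colouring-unique : ∀ π → Distinct π → ∀ w w' → ValidColouring w → ValidColouring w' → Good π w → Good π w' → w ≡ w'
  good-colouring-unique (p1 ∷ πr) d w w' v v' = SortedSummand.TwoColourings.colouring-unique n' r' p1 πr d e w w' v v'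

  Sn-distinct : All Distinct (Sn n)
  Sn-distinct = All.map T⇒≡true (AllP.all-filter (λ π → T? (distinctB (toList π))) (allVecs (List.allFin n) n))

  I-valid : All ValidColouring (I r n)
  I-valid = All.zipWith (λ { ((d , c<r) , nil) → d , c<r , T⇒≡true nil })
    ( AllP.filter⁺ (λ w → T? (isNil (DesA w))) allColored-ok
    , AllP.all-filter (λ w → T? (isNil (DesA w))) (allColored r n))
    where
    allColored-ok : All (λ w → Distinct (proj₁ w) × (∀ i → lookup (proj₂ w) i < r)) (allColored r n)
    allColored-ok = AllP.concat⁺ (AllP.map⁺ (All.map (λ dπ → AllP.map⁺ (All.map (dπ ,_)
      (allVecs-All (upTo r) n (AllP.applyUpTo⁺₁ id r id)))) Sn-distinct))

  countEq-Sn : ∀ π → Distinct π → countEq _≟π_ π (Sn n) ≡ 1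
  countEq-Sn π d =
    trans (countEq-filter _≟π_ (λ π → T? (distinctB (toList π))) π (allVecs (List.allFin n) n) (≡true⇒T d))
          (countEq-allVecs FinP._≟_ (List.allFin n) n π (λ i → countEq-tabulate FinP._≟_ id (λ a b e → e) (lookup π i)))

  countEq-I : ∀ w → ValidColouring w → countEq _≟w_ w (I r n) ≡ 1
  countEq-I w@(ρ , c) (dρ , c<r , nil) =
    trans (countEq-filter _≟w_ (λ w → T? (isNil (DesA w))) w (allColored r n) (≡true⇒T nil))
      (trans (countEq-concatMap-map _≟π_ (VP.≡-dec ℕP._≟_) _≟w_ _,_ ×P.,-injective ρ c (Sn n) (allVecs (upTo r) n))
        (cong₂ _*_ (countEq-Sn ρ dρ) (countEq-allVecs ℕP._≟_ (upTo r) n c (λ i → countEq-upTo r (lookup c i) (c<r i)))))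

  sorted-good : (∀ c → x c ≤ e0) → Σ (Vec (Fin n) n) λ π → Distinct π × Σ (Colored n) λ w → ValidColouring w × Good π w
  sorted-good x≤e0 with ByKey.isort x (Vec.allFin n) | ByKey.sorted-isort x (Vec.allFin n) (distinctB-allFinVec n)
  ... | π@(p1 ∷ πr) | sorted = π , d , B.w* , B.valid ,
        x≤e0 p1 , F.Construct.construct-staircase B.w* B.multOf-w* [] p1 (toList πr) refl
            (ByKey.sorted⇒linked x (toList π) sorted)
    where
    d : Distinct π
    d = ByKey.sorted⇒distinct x (toList π) sorted
    module F = SortedSummand n' r' p1 πr d e
    module B = ColouringFromMultiplicities n r' (F.forcedMult (toList π)) (F.forcedMult<r (toList π))

  colourings-Iverson : ∀ π → Distinct π →
    Iverson (Σ (Colored n) λ w → ValidColouring w × Good π w) (sumℤ (map (λ w → rhsTerm r n π w e) (I r n)))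
  colourings-Iverson π d = Iverson-sumℤ _≟w_ (I r n) ValidColouring (Good π) (λ w → rhsTerm r n π w e) I-valid
    (λ w _ → summand-Iverson π d w) _
    (λ { (w , v , g) → w , v , g , countEq-I w v }) (λ w v g → w , v , g)
    (λ w w' v v' → good-colouring-unique π d w w' v v')

  RHS-sum : RHS r n e ≡ sumℤ (map (λ π → sumℤ (map (λ w → rhsTerm r n π w e) (I r n))) (Sn n))
  RHS-sum = begin
      RHS r n e
    ≡⟨ sumS-apply (concatMap (λ π → map (rhsTerm r n π) (I r n)) (Sn n)) e ⟩
      sumℤ (map (λ f → f e) (concatMap (λ π → map (rhsTerm r n π) (I r n)) (Sn n)))
    ≡⟨ sumℤ-concatMap (λ f → f e) (λ π → map (rhsTerm r n π) (I r n)) (Sn n) ⟩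
      sumℤ (map (λ π → sumℤ (map (λ f → f e) (map (rhsTerm r n π) (I r n)))) (Sn n))
    ≡⟨ sumℤ-cong (Sn n) (λ π → sumℤ-map-∘ (λ f → f e) (rhsTerm r n π) (I r n)) ⟩
      sumℤ (map (λ π → sumℤ (map (λ w → rhsTerm r n π w e) (I r n))) (Sn n)) ∎
    where open ≡-Reasoning

  RHS-Iverson : Iverson (∀ c → x c ≤ e0) (RHS r n e)
  RHS-Iverson = subst (Iverson _) (sym RHS-sum)
    (Iverson-sumℤ _≟π_ (Sn n) Distinct (λ π → Σ (Colored n) λ w → ValidColouring w × Good π w) _ Sn-distinct colourings-Iverson _
      (λ x≤e0 → let (π , d , good) = sorted-good x≤e0 in π , d , good , countEq-Sn π d)
      (λ { π d (w , _ , g) → good-bounded π d w g })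
      (λ { π π' d d' (w , _ , g) (w' , _ , g') → good-permutation-unique π π' d d' w w' g g' }))

theorem5p14 : (r n : ℕ) → 1 ≤ r → 1 ≤ n →
    (e : Exp (suc n)) → LHS n e ≡ RHS r n e
theorem5p14 (suc r') (suc n') _ _ (e0 ∷ xs) =
  Iverson-unique (FinP.all? (λ i → lookup xs i ℕP.≤? e0))
    (LHS-Iverson (suc n') e0 xs) (RHSCoefficient.RHS-Iverson r' n' e0 xs)
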